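{- For $n\ge2$ and $w\in S_n$, $$\mathcal G^{A_{n-1}}_w(a,b)=\sum_{\mathbf D\in\mathrm{RSub}(\Delta^A_{n-1},w)}\mathrm{Wt}(\mathbf D),\qquad \mathrm{Wt}(\mathbf D)=\prod_{d\in\mathbf D}\mathrm{wt}(d)\times\prod_{d\in B(\mathbf D)}\big(1+\beta\,\mathrm{wt}(d)\big).$$
   Context: Let $\beta$ be an indeterminate, $x\oplus y=x+y+\beta xy$, $\bar x=-x/(1+\beta x)$. $\mathrm{Id}_\beta(S_n)$ is the $\mathbb Z[\beta]$-algebra generated by $u_1,\dots,u_{n-1}$ with $u_i^2=\beta u_i$, $u_iu_j=u_ju_i$ ($|i-j|>1$), $u_iu_{i+1}u_i=u_{i+1}u_iu_{i+1}$; $u_w=u_{i_1}\cdots u_{i_\ell}$ for a reduced word of $w$. Variables commute with $u_i$; $h_i(x)=1+xu_i$, $A^{(n)}_i(x)=h_{n-1}(x)\cdots h_i(x)$, $G_{A_{n-1}}(a_1,\dots,a_{n-1})=A^{(n)}_1(a_1)\cdots A^{(n)}_{n-1}(a_{n-1})$. $\mathcal G^{A_{n-1}}_w(a,b)$ is the coefficient of $u_w$ in $G_{A_{n-1}}(\bar b_1,\dots,\bar b_{n-1})^{ -1}G_{A_{n-1}}(a_1,\dots,a_{n-1})$. $\Delta^A_{n-1}=(d_1,\dots,d_N)$, $N=n(n-1)/2$, is the sequence of boxes at positions $(i,j)$ with $i,j\ge1$, $i+j\le n$, listed for $j=n-1,n-2,\dots,1$ and, for each $j$, $i=1,\dots,n-j$;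 the box at $(i,j)$ carries the simple reflection $s_{i+j-1}$ and weight $\mathrm{wt}=a_i\oplus b_j$ (so as a word $\Delta^A_{n-1}=(s_{n-1}\,|\,s_{n-2},s_{n-1}\,|\,\cdots\,|\,s_1,\dots,s_{n-1})$). For a sequence $\Delta=(d_1,\dots,d_N)$ of simple reflections and $w$ of length $\ell$, $\mathrm{RSub}(\Delta,w)$ is the set of subsequences $\mathbf D=(d_{j_1},\dots,d_{j_\ell})$, $j_1<\dots<j_\ell$, with $d_{j_1}\cdots d_{j_\ell}=w$ (so a reduced word). Setting $j_{\ell+1}=N+1$, $B(\mathbf D)$ is the set of positions $j\le N$ with $j_p<j<j_{p+1}$ for some $p$ such that $(d_{j_1}\cdots d_{j_p})\star d_j=d_{j_1}\cdots d_{j_p}$, where $\star$ is the Demazure product ($u_yu_z=\beta^{\ell(y)+\ell(z)-\ell(y\star z)}u_{y\star z}$); equivalently $\ell(d_{j_1}\cdots d_{j_p}d_j)<\ell(d_{j_1}\cdots d_{j_p})$. -}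

module Defs where

open import Level using (Level)
open import Data.Nat using (ℕ; zero; suc; _∸_; _<_; _<?_; _≤_)
import Data.Nat as N
open import Data.Bool using (Bool; true; false; if_then_else_)
open import Data.Product using (_×_; _,_; proj₁; proj₂)
open import Data.List using (List; []; _∷_; _++_; map; foldr; foldl; length; filter; concatMap; upTo; downFrom; reverse)
open import Data.List.Properties using (≡-dec)
open import Data.List.Relation.Unary.All using (All)
open import Relation.Nullary using (does; yes; no)
open import Relation.Binary.PropositionalEquality using (_≡_)
open import Algebra.Bundles using (CommutativeRing)

-- Permutations of {0,…,n-1} in one-line notation (lists of naturals).
-- The identity of S_n is  upTo n = [0,1,…,n-1];  w ∈ S_n  iff  w ↭ upTo n.

swapAt : ℕ → List ℕ → List ℕ
swapAt zero    (x ∷ y ∷ xs) = y ∷ x ∷ xs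
swapAt (suc k) (x ∷ xs)     = x ∷ swapAt k xs
swapAt _       xs           = xs

-- right multiplication by the simple reflection s_i  (i ≥ 1): v ↦ v s_i
rmul : List ℕ → ℕ → List ℕ
rmul v i = swapAt (i ∸ 1) v

len : List ℕ → ℕ
len []       = 0
len (x ∷ xs) = length (filter (_<? x) xs) N.+ len xs

prod : ℕ → List ℕ → List ℕ
prod n word = foldl rmul (upTo n) word

dstep : List ℕ → ℕ → List ℕ
dstep v i with len v <? len (rmul v i)
... | yes _ = rmul v i
... | no  _ = v

dem : ℕ → List ℕ → List ℕ
dem n word = foldl dstep (upTo n) word

from1 : ℕ → List ℕ
from1 m = map suc (upTo m)

module Hecke {c ℓ : Level} (R : CommutativeRing c ℓ)
             (β : CommutativeRing.Carrier R) where

  open CommutativeRing R public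

  _⊕_ : Carrier → Carrier → Carrier
  x ⊕ y = x + y + β * x * y

  -- x̄ = -x/(1+βx), given an inverse xinv of 1+βx
  bar : Carrier → Carrier → Carrier
  bar x xinv = - (x * xinv)

  pow : Carrier → ℕ → Carrier
  pow x zero    = 1#
  pow x (suc k) = x * pow x k

  sumR : List Carrier → Carrier
  sumR = foldr _+_ 0#

  prodR : List Carrier → Carrier
  prodR = foldr _*_ 1#

  -- Elements of R ⊗ Id_β(S_n): finite formal sums  Σ c · u_{i_1}⋯u_{i_k}
  -- (each entry is a word in the generators u_i together with a coefficient).
  Elem : Set c
  Elem = List (List ℕ × Carrier)

  one : Elem
  one = ([] , 1#) ∷ []

  _·_ : Elem → Elem → Elem
  X · Y = concatMap (λ p → map (λ q → (proj₁ p ++ proj₁ q , proj₂ p * proj₂ q)) Y) X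

  InAlg : ℕ → Elem → Set c
  InAlg n X = All (λ p → All (λ i → 1 ≤ i × i < n) (proj₁ p)) X

  -- coefficient of u_w.  In Id_β(S_n),  u_{i_1}⋯u_{i_k} = β^{k-ℓ(v)} u_v
  -- with v = s_{i_1} ⋆ ⋯ ⋆ s_{i_k} (Demazure product), and {u_w} is a basis.
  coeff : ℕ → List ℕ → Elem → Carrier
  coeff n w X = sumR (map term X)
    where
    term : List ℕ × Carrier → Carrier
    term (word , x) =
      if does (≡-dec N._≟_ (dem n word) w)
      then x * pow β (length word ∸ len w)
      else 0#

  _≈[_]_ : Elem → ℕ → Elem → Set _
  X ≈[ n ] Y = (w : List ℕ) → w ↭' n → coeff n w X ≈ coeff n w Y
    where
    open import Data.List.Relation.Binary.Permutation.Propositional using (_↭_)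
    _↭'_ : List ℕ → ℕ → Set
    v ↭' m = v ↭ upTo m

  h : ℕ → Carrier → Elem
  h i x = ([] , 1#) ∷ ((i ∷ []) , x) ∷ []

  A : ℕ → ℕ → Carrier → Elem
  A n i x = foldr _·_ one (map (λ k → h k x) (reverse (map (i N.+_) (upTo (n ∸ i)))))

  G : ℕ → (ℕ → Carrier) → Elem
  G n a = foldr _·_ one (map (λ i → A n i (a i)) (from1 (n ∸ 1)))

  -- The sequence Δ^A_{n-1}: boxes (i,j), listed for j = n-1,…,1 and
  -- i = 1,…,n-j; box (i,j) carries s_{i+j-1} and weight a_i ⊕ b_j.
  Box : Set
  Box = ℕ × ℕ

  Δ : ℕ → List Box
  Δ n = concatMap (λ j → map (λ i → (i , j)) (from1 (n ∸ j))) (map suc (downFrom (n ∸ 1)))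

  sref : Box → ℕ
  sref (i , j) = i N.+ j ∸ 1

  -- subsequences of a list, as markings (true = selected)
  marks : {A : Set} → List A → List (List (Bool × A))
  marks []       = [] ∷ []
  marks (x ∷ xs) = concatMap (λ s → ((true , x) ∷ s) ∷ ((false , x) ∷ s) ∷ []) (marks xs)

  selected : List (Bool × Box) → List ℕ
  selected []                = []
  selected ((true  , d) ∷ m) = sref d ∷ selected m
  selected ((false , d) ∷ m) = selected m

  module _ (a b : ℕ → Carrier) where

    wt : Box → Carrier
    wt (i , j) = a i ⊕ b j

    -- Wt(D), walking through Δ with v = product of the selected prefix;
    -- an unselected position j is in B(D) iff ℓ(v d_j) < ℓ(v).
    walk : List ℕ → List (Bool × Box) → Carrier
    walk v []                = 1#
    walk v ((true  , d) ∷ m) = wt d * walk (rmul v (sref d)) m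
    walk v ((false , d) ∷ m) with len (rmul v (sref d)) <? len v
    ... | yes _ = (1# + β * wt d) * walk v m
    ... | no  _ = walk v m

    Wt : ℕ → List (Bool × Box) → Carrier
    Wt n m = walk (upTo n) m

    isRSub : ℕ → List ℕ → List (Bool × Box) → Bool
    isRSub n w m = does (≡-dec N._≟_ (prod n (selected m)) w)
                   Data.Bool.∧ does (length (selected m) N.≟ len w)
      where import Data.Bool

    rhs : ℕ → List ℕ → Carrier
    rhs n w = sumR (map (λ m → if isRSub n w m then Wt n m else 0#) (marks (Δ n)))

-- Id_β(S_n) acts on functions f of permutations by (u_i f)(v) = f(v s_i) if ℓ(v s_i) > ℓ(v) and β f(v)
-- otherwise, so that (Z f)(id) = Σ_w coeff_w(Z) f(w); in particular coeff_w(Z) = (Z δ_w)(id), and Z acts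
-- at id as the identity whenever Z ≈ 1.  In this action h_i(x) h_i(y) = h_i(x ⊕ y), the far
-- commutations and the Yang–Baxter relation h_i(x) h_{i+1}(x ⊕ y) h_i(y) = h_{i+1}(y) h_i(x ⊕ y) h_{i+1}(x)
-- hold, and they give the factorisation G(a) = G(b̄) · ∏_{(i,j) ∈ Δ} h_{i+j-1}(a_i ⊕ b_j), where b̄_j ⊕ b_j = 0.
-- Hence X·G(a) acts at id as the product over Δ.  Expanding that product box by box from the identity,
-- a selected box at an ascent contributes wt, while at a descent the two terms of 1 + wt u collapse to
-- (1 + β wt) times the unselected term; evaluating at δ_w keeps exactly the reduced subwords D for w,
-- each with weight Wt(D).

module Submission where

open import Defs
open import Level using (Level)
open import Algebra.Bundles using (CommutativeRing)
open import Data.Nat using (ℕ; zero; suc; _∸_; _<_; _<?_; _≤_; z≤n; s≤s)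
import Data.Nat as ℕ
open import Data.Bool using (Bool; true; false; if_then_else_; T; _∧_)
open import Data.List using (List; []; _∷_; [_]; _++_; map; foldl; foldr; length; filter; upTo; applyUpTo; reverse; concatMap; deduplicate)
open import Data.List.Properties using (≡-dec; map-++; map-concatMap; ++-assoc; ++-identityʳ; length-map; unfold-reverse; concatMap-map; concatMap-pure; length-upTo)
open import Data.List.Relation.Unary.All as All using (All; []; _∷_)
open import Data.List.Relation.Unary.All.Properties using (applyUpTo⁺₁; applyDownFrom⁺₁; map⁺; ++⁺; concat⁺; All¬⇒¬Any)
open import Data.List.Relation.Unary.Any using (here; there)
open import Data.List.Membership.Propositional using (_∈_)
open import Data.List.Membership.Propositional.Properties using (∈-deduplicate⁺; ∈-deduplicate⁻; ∈-map⁺; ∈-map⁻)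
open import Data.List.Relation.Unary.Unique.DecPropositional.Properties using (deduplicate-!)
open import Data.List.Relation.Unary.AllPairs using ([]; _∷_)
open import Data.List.Relation.Unary.Unique.Propositional using (Unique)
open import Data.List.Relation.Unary.Unique.Propositional.Properties using (upTo⁺)
open import Data.List.Relation.Binary.Permutation.Propositional using (_↭_; ↭-sym; ↭-refl; ↭-trans; ↭-prep; ↭-swap)
open import Data.List.Relation.Binary.Permutation.Propositional.Properties using (↭-length; filter-↭; All-resp-↭; ↭-reverse)
open import Data.Product using (_×_; _,_; proj₁; proj₂; Σ-syntax)
open import Relation.Binary.Definitions using (tri<; tri≈; tri>; DecidableEquality)
open import Relation.Binary.Bundles using (Setoid)
import Relation.Binary.Reasoning.Setoid as SetoidReasoning
open import Data.Empty using (⊥-elim)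
open import Function using (id; _∘_)
open import Relation.Nullary using (¬_; yes; no; does)
open import Relation.Nullary.Decidable using (dec-true; dec-false)
open import Relation.Binary.PropositionalEquality as ≡ using (_≡_; _≢_)
import Data.Nat.Properties as ℕₚ

module OneLineNotation where

  open import Data.Nat using (_+_)
  open import Data.Nat.Properties
  open import Algebra.Properties.CommutativeSemigroup +-commutativeSemigroup using (x∙yz≈y∙xz)
  open ≡ using (refl; sym; trans; cong; cong₂; subst; module ≡-Reasoning)

  ascent : ℕ → List ℕ → Bool
  ascent zero    (x ∷ y ∷ _) = does (x <? y)
  ascent (suc k) (_ ∷ v)     = ascent k v
  ascent _       _           = false

  ascent-< : ∀ {x y} → does (x <? y) ≡ true → x < y
  ascent-< {x} {y} asc = <ᵇ⇒< x y (subst T (sym asc) _)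

  ascent-≮ : ∀ {x y} → does (x <? y) ≡ false → ¬ x < y
  ascent-≮ {x} {y} asc x<y with () ← trans (sym (dec-true (x <? y) x<y)) asc

  swapAt-involutive : ∀ k (v : List ℕ) → swapAt k (swapAt k v) ≡ v
  swapAt-involutive zero    []          = refl
  swapAt-involutive zero    (x ∷ [])    = refl
  swapAt-involutive zero    (x ∷ y ∷ v) = refl
  swapAt-involutive (suc k) []          = refl
  swapAt-involutive (suc k) (x ∷ v)     = cong (x ∷_) (swapAt-involutive k v)

  swapAt-↭ : ∀ k (v : List ℕ) → swapAt k v ↭ v
  swapAt-↭ zero    []          = ↭-refl
  swapAt-↭ zero    (x ∷ [])    = ↭-refl
  swapAt-↭ zero    (x ∷ y ∷ v) = ↭-swap y x ↭-refl
  swapAt-↭ (suc k) []          = ↭-refl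
  swapAt-↭ (suc k) (x ∷ v)     = ↭-prep x (swapAt-↭ k v)

  Unique-swapAt : ∀ k {v : List ℕ} → Unique v → Unique (swapAt k v)
  Unique-swapAt zero    {[]}        u = u
  Unique-swapAt zero    {x ∷ []}    u = u
  Unique-swapAt zero    {x ∷ y ∷ v} ((x≢y ∷ x∉v) ∷ y∉v ∷ u) = ((x≢y ∘ sym) ∷ y∉v) ∷ x∉v ∷ u
  Unique-swapAt (suc k) {[]}        u = u
  Unique-swapAt (suc k) {x ∷ v}     (x∉v ∷ u) =
    All-resp-↭ (↭-sym (swapAt-↭ k v)) x∉v ∷ Unique-swapAt k u

  swapAt-comm : ∀ p r (v : List ℕ) → swapAt p (swapAt (2 + p + r) v) ≡ swapAt (2 + p + r) (swapAt p v)
  swapAt-comm zero    r []          = refl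
  swapAt-comm zero    r (x ∷ [])    = refl
  swapAt-comm zero    r (x ∷ y ∷ v) = refl
  swapAt-comm (suc p) r []          = refl
  swapAt-comm (suc p) r (x ∷ v)     = cong (x ∷_) (swapAt-comm p r v)

  ascent-swapAt-far : ∀ p r (v : List ℕ) → ascent (2 + p + r) (swapAt p v) ≡ ascent (2 + p + r) v
  ascent-swapAt-far zero    r []          = refl
  ascent-swapAt-far zero    r (x ∷ [])    = refl
  ascent-swapAt-far zero    r (x ∷ y ∷ v) = refl
  ascent-swapAt-far (suc p) r []          = refl
  ascent-swapAt-far (suc p) r (x ∷ v)     = ascent-swapAt-far p r v

  ascent-far-swapAt : ∀ p r (v : List ℕ) → ascent p (swapAt (2 + p + r) v) ≡ ascent p v
  ascent-far-swapAt zero    r []          = refl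
  ascent-far-swapAt zero    r (x ∷ [])    = refl
  ascent-far-swapAt zero    r (x ∷ y ∷ v) = refl
  ascent-far-swapAt (suc p) r []          = refl
  ascent-far-swapAt (suc p) r (x ∷ v)     = ascent-far-swapAt p r v

  ascent-swapAt-ascent : ∀ k (v : List ℕ) → ascent k v ≡ true → ascent k (swapAt k v) ≡ false
  ascent-swapAt-ascent zero (x ∷ y ∷ w) asc = dec-false (y <? x) (<-asym (ascent-< asc))
  ascent-swapAt-ascent (suc k) (x ∷ v) asc = ascent-swapAt-ascent k v asc

  ascent-swapAt-descent : ∀ k (v : List ℕ) → Unique v → suc k < length v →
                          ascent k v ≡ false → ascent k (swapAt k v) ≡ true
  ascent-swapAt-descent zero (x ∷ y ∷ w) ((x≢y ∷ _) ∷ _) _ asc =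
    dec-true (y <? x) (≤∧≢⇒< (≮⇒≥ (ascent-≮ asc)) (x≢y ∘ sym))
  ascent-swapAt-descent zero    (x ∷ [])    _ (s≤s ()) _
  ascent-swapAt-descent (suc k) (x ∷ v) (_ ∷ u) (s≤s k<) asc = ascent-swapAt-descent k v u k< asc

  -- len (x ∷ xs) unfolds to smaller x xs + len xs
  smaller : ℕ → List ℕ → ℕ
  smaller x xs = length (filter (_<? x) xs)

  smaller-↭ : ∀ x {u v : List ℕ} → u ↭ v → smaller x u ≡ smaller x v
  smaller-↭ x p = ↭-length (filter-↭ (_<? x) p)

  smaller-∷-< : ∀ {x y} ys → y < x → smaller x (y ∷ ys) ≡ suc (smaller x ys)
  smaller-∷-< {x} {y} ys y<x rewrite dec-true (y <? x) y<x = refl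

  smaller-∷-≮ : ∀ {x y} ys → ¬ y < x → smaller x (y ∷ ys) ≡ smaller x ys
  smaller-∷-≮ {x} {y} ys y≮x rewrite dec-false (y <? x) y≮x = refl

  smaller-∷-≤ : ∀ x y ys → smaller x ys ≤ smaller x (y ∷ ys)
  smaller-∷-≤ x y ys with y <? x
  ... | yes y<x = ≤-trans (n≤1+n _) (≤-reflexive (sym (smaller-∷-< ys y<x)))
  ... | no  y≮x = ≤-reflexive (sym (smaller-∷-≮ ys y≮x))

  len-swapAt-ascent : ∀ k (v : List ℕ) → ascent k v ≡ true → len (swapAt k v) ≡ suc (len v)
  len-swapAt-ascent zero (x ∷ y ∷ w) asc = begin
    smaller y (x ∷ w) + (smaller x w + len w)   ≡⟨ cong (_+ (smaller x w + len w)) (smaller-∷-< w x<y) ⟩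
    suc (smaller y w + (smaller x w + len w))   ≡⟨ cong suc (x∙yz≈y∙xz (smaller y w) (smaller x w) (len w)) ⟩
    suc (smaller x w + (smaller y w + len w))   ≡⟨ cong (λ s → suc (s + (smaller y w + len w))) (smaller-∷-≮ w (<-asym x<y)) ⟨
    suc (smaller x (y ∷ w) + (smaller y w + len w)) ∎
    where open ≡-Reasoning
          x<y = ascent-< asc
  len-swapAt-ascent (suc k) (x ∷ v) asc = begin
    smaller x (swapAt k v) + len (swapAt k v) ≡⟨ cong₂ _+_ (smaller-↭ x (swapAt-↭ k v)) (len-swapAt-ascent k v asc) ⟩
    smaller x v + suc (len v)                 ≡⟨ +-suc (smaller x v) (len v) ⟩
    suc (smaller x v + len v)                 ∎
    where open ≡-Reasoning

  len-swapAt-≤ : ∀ k (v : List ℕ) → ascent k v ≡ false → len (swapAt k v) ≤ len v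
  len-swapAt-≤ zero    []          _ = ≤-refl
  len-swapAt-≤ zero    (x ∷ [])    _ = ≤-refl
  len-swapAt-≤ zero    (x ∷ y ∷ w) asc = begin
    smaller y (x ∷ w) + (smaller x w + len w)   ≡⟨ cong (_+ (smaller x w + len w)) (smaller-∷-≮ w (≤⇒≯ (≮⇒≥ x≮y))) ⟩
    smaller y w + (smaller x w + len w)         ≡⟨ x∙yz≈y∙xz (smaller y w) (smaller x w) (len w) ⟩
    smaller x w + (smaller y w + len w)         ≤⟨ +-monoˡ-≤ (smaller y w + len w) (smaller-∷-≤ x y w) ⟩
    smaller x (y ∷ w) + (smaller y w + len w)   ∎
    where open ≤-Reasoning
          x≮y = ascent-≮ asc
  len-swapAt-≤ (suc k) []      _   = ≤-refl
  len-swapAt-≤ (suc k) (x ∷ v) asc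
    rewrite smaller-↭ x (swapAt-↭ k v) = +-monoʳ-≤ (smaller x v) (len-swapAt-≤ k v asc)

  len-swapAt-descent : ∀ k (v : List ℕ) → Unique v → suc k < length v →
                       ascent k v ≡ false → suc (len (swapAt k v)) ≡ len v
  len-swapAt-descent k v u k< asc = begin
    suc (len (swapAt k v))             ≡⟨ len-swapAt-ascent k (swapAt k v) (ascent-swapAt-descent k v u k< asc) ⟨
    len (swapAt k (swapAt k v))        ≡⟨ cong len (swapAt-involutive k v) ⟩
    len v                              ∎
    where open ≡-Reasoning

  len-swapAt-≤-suc : ∀ k (v : List ℕ) → len (swapAt k v) ≤ suc (len v)
  len-swapAt-≤-suc k v with ascent k v in asc
  ... | true  = ≤-reflexive (len-swapAt-ascent k v asc)
  ... | false = m≤n⇒m≤1+n (len-swapAt-≤ k v asc)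

  dstep-ascent : ∀ (v : List ℕ) i → dstep v i ≡ (if ascent (i ∸ 1) v then rmul v i else v)
  dstep-ascent v i with len v <? len (rmul v i) | ascent (i ∸ 1) v in asc
  ... | yes _   | true  = refl
  ... | no  _   | false = refl
  ... | yes lt  | false = ⊥-elim (<⇒≱ lt (len-swapAt-≤ (i ∸ 1) v asc))
  ... | no  ≮   | true  = ⊥-elim (≮ (≤-reflexive (sym (len-swapAt-ascent (i ∸ 1) v asc))))

  foldl-dstep-↭ : ∀ (p : List ℕ) {u v : List ℕ} → v ↭ u → foldl dstep v p ↭ u
  foldl-dstep-↭ []      v↭u = v↭u
  foldl-dstep-↭ (i ∷ p) {v = v} v↭u rewrite dstep-ascent v i with ascent (i ∸ 1) v
  ... | true  = foldl-dstep-↭ p (↭-trans (swapAt-↭ (i ∸ 1) v) v↭u)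
  ... | false = foldl-dstep-↭ p v↭u

  len-foldl-rmul : ∀ (ws : List ℕ) (v : List ℕ) → len (foldl rmul v ws) ≤ length ws + len v
  len-foldl-rmul []       v = ≤-refl
  len-foldl-rmul (i ∷ ws) v = begin
    len (foldl rmul (rmul v i) ws)   ≤⟨ len-foldl-rmul ws (rmul v i) ⟩
    length ws + len (rmul v i)       ≤⟨ +-monoʳ-≤ (length ws) (len-swapAt-≤-suc (i ∸ 1) v) ⟩
    length ws + suc (len v)          ≡⟨ +-suc (length ws) (len v) ⟩
    suc (length ws + len v)          ∎
    where open ≤-Reasoning

  smaller-of-≤ : ∀ x (v : List ℕ) → All (x ≤_) v → smaller x v ≡ 0
  smaller-of-≤ x []      []         = refl
  smaller-of-≤ x (y ∷ v) (x≤y ∷ ps) = trans (smaller-∷-≮ v (≤⇒≯ x≤y)) (smaller-of-≤ x v ps)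

  len-applyUpTo : ∀ (f : ℕ → ℕ) m → (∀ {i j} → i < j → f i < f j) → len (applyUpTo f m) ≡ 0
  len-applyUpTo f zero    mono = refl
  len-applyUpTo f (suc m) mono = cong₂ _+_
    (smaller-of-≤ (f 0) (applyUpTo (f ∘ suc) m) (applyUpTo⁺₁ (f ∘ suc) m λ _ → <⇒≤ (mono (s≤s z≤n))))
    (len-applyUpTo (f ∘ suc) m (mono ∘ s≤s))

  len-upTo : ∀ n → len (upTo n) ≡ 0
  len-upTo n = len-applyUpTo id n id


open OneLineNotation

module Ranges where

  open import Data.Nat using (_+_)
  open import Data.Nat.Properties using (+-identityʳ; +-suc; m≤n⇒m≤1+n)
  open import Data.List using (downFrom)
  open import Data.List.Properties using (map-upTo)
  open ≡ using (refl; sym; trans; cong; cong₂)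

  range : ℕ → ℕ → List ℕ
  range i zero    = []
  range i (suc m) = i ∷ range (suc i) m

  rangeDown : ℕ → ℕ → List ℕ
  rangeDown s zero    = []
  rangeDown s (suc m) = s + m ∷ rangeDown s m

  applyUpTo≡range : ∀ (g : ℕ → ℕ) i m → (∀ k → g k ≡ i + k) → applyUpTo g m ≡ range i m
  applyUpTo≡range g i zero    g≗ = refl
  applyUpTo≡range g i (suc m) g≗ =
    cong₂ _∷_ (trans (g≗ 0) (+-identityʳ i)) (applyUpTo≡range (g ∘ suc) (suc i) m (λ k → trans (g≗ (suc k)) (+-suc i k)))

  map-+-upTo : ∀ i m → map (i +_) (upTo m) ≡ range i m
  map-+-upTo i m = trans (map-upTo (i +_) m) (applyUpTo≡range (i +_) i m λ _ → refl)

  range-∷ʳ : ∀ i m → range i (suc m) ≡ range i m ++ i + m ∷ []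
  range-∷ʳ i zero    = cong (_∷ []) (sym (+-identityʳ i))
  range-∷ʳ i (suc m) = cong (i ∷_) (trans (range-∷ʳ (suc i) m) (cong (λ k → range (suc i) m ++ k ∷ []) (sym (+-suc i m))))

  length-range : ∀ i m → length (range i m) ≡ m
  length-range i zero    = refl
  length-range i (suc m) = cong suc (length-range (suc i) m)

  range-≥ : ∀ {t} i m → t ≤ i → All (t ≤_) (range i m)
  range-≥ i zero    t≤i = []
  range-≥ i (suc m) t≤i = t≤i ∷ range-≥ (suc i) m (m≤n⇒m≤1+n t≤i)

  rangeDown-∷ʳ : ∀ s m → rangeDown s (suc m) ≡ rangeDown (suc s) m ++ s ∷ []
  rangeDown-∷ʳ s zero    = cong (_∷ []) (+-identityʳ s)
  rangeDown-∷ʳ s (suc m) = cong₂ _∷_ (+-suc s m) (rangeDown-∷ʳ s m)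

  map-suc-downFrom : ∀ m → map suc (downFrom m) ≡ rangeDown 1 m
  map-suc-downFrom zero    = refl
  map-suc-downFrom (suc m) = cong (suc m ∷_) (map-suc-downFrom m)

  rangeDown-≥1 : ∀ m → All (1 ≤_) (rangeDown 1 m)
  rangeDown-≥1 zero    = []
  rangeDown-≥1 (suc m) = s≤s z≤n ∷ rangeDown-≥1 m

open Ranges

module ListSums {c ℓ : Level} (R : CommutativeRing c ℓ) where

  open CommutativeRing R
  open import Algebra.Solver.Ring.NaturalCoefficients.Default commutativeSemiring using (solve; _:=_; _:+_)

  sum : List Carrier → Carrier
  sum = foldr _+_ 0#

  sum-++ : ∀ xs ys → sum (xs ++ ys) ≈ sum xs + sum ys
  sum-++ []       ys = sym (+-identityˡ _)
  sum-++ (x ∷ xs) ys = trans (+-congˡ (sum-++ xs ys)) (sym (+-assoc _ _ _))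

  module _ {a} {A : Set a} where

    sum-cong-∈ : ∀ (L : List A) {F G : A → Carrier} → (∀ {u} → u ∈ L → F u ≈ G u) → sum (map F L) ≈ sum (map G L)
    sum-cong-∈ []      F≈G = refl
    sum-cong-∈ (u ∷ L) F≈G = +-cong (F≈G (here ≡.refl)) (sum-cong-∈ L (F≈G ∘ there))

    sum-cong : ∀ (L : List A) {F G : A → Carrier} → (∀ u → F u ≈ G u) → sum (map F L) ≈ sum (map G L)
    sum-cong L F≈G = sum-cong-∈ L (λ {u} _ → F≈G u)

    sum-+ : ∀ (L : List A) (F G : A → Carrier) → sum (map (λ u → F u + G u) L) ≈ sum (map F L) + sum (map G L)
    sum-+ []      F G = sym (+-identityˡ _)
    sum-+ (u ∷ L) F G = trans (+-congˡ (sum-+ L F G))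
      (solve 4 (λ a b c d → (a :+ b) :+ (c :+ d) := (a :+ c) :+ (b :+ d)) refl (F u) (G u) _ _)

    sum-*ˡ : ∀ (L : List A) y (F : A → Carrier) → sum (map (λ u → y * F u) L) ≈ y * sum (map F L)
    sum-*ˡ []      y F = sym (zeroʳ y)
    sum-*ˡ (u ∷ L) y F = trans (+-congˡ (sum-*ˡ L y F)) (sym (distribˡ y _ _))

    sum-0 : ∀ (L : List A) → sum (map (λ _ → 0#) L) ≈ 0#
    sum-0 []      = refl
    sum-0 (u ∷ L) = trans (+-identityˡ _) (sum-0 L)

    sum-pairs : ∀ (L : List A) (F G : A → Carrier) → sum (concatMap (λ u → F u ∷ G u ∷ []) L) ≈ sum (map (λ u → F u + G u) L)
    sum-pairs []      F G = refl
    sum-pairs (u ∷ L) F G = trans (sym (+-assoc _ _ _)) (+-congˡ (sum-pairs L F G))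

    sum-δ : (_≟_ : DecidableEquality A) → ∀ d (L : List A) → Unique L → d ∈ L → (F G : A → Carrier) →
            sum (map (λ u → (if does (d ≟ u) then F u else 0#) * G u) L) ≈ F d * G d
    sum-δ _≟_ d (u ∷ L) (d∉L ∷ uL) d∈ F G with d ≟ u
    ... | yes ≡.refl = trans (+-congˡ (trans (sum-cong-∈ L off) (sum-0 L))) (+-identityʳ _)
      where off : ∀ {u} → u ∈ L → (if does (d ≟ u) then F u else 0#) * G u ≈ 0#
            off {u} u∈L with d ≟ u
            ... | yes ≡.refl = ⊥-elim (All¬⇒¬Any d∉L u∈L)
            ... | no  _      = zeroˡ _
    ... | no d≢u with d∈
    ...   | here d≡u  = ⊥-elim (d≢u d≡u)
    ...   | there d∈L = trans (+-cong (zeroˡ _) (sum-δ _≟_ d L uL d∈L F G)) (+-identityˡ _)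


module HeckeAction {c ℓ : Level} (R : CommutativeRing c ℓ) (β : CommutativeRing.Carrier R) (n : ℕ) where

  open Hecke R β
  open SetoidReasoning setoid
  open import Algebra.Solver.Ring.NaturalCoefficients.Default commutativeSemiring using (solve; _:=_; _:+_; _:*_; con)

  Fn : Set c
  Fn = List ℕ → Carrier

  Distinct : List ℕ → Set
  Distinct v = Unique v × length v ≡ n

  Distinct-swapAt : ∀ k {v} → Distinct v → Distinct (swapAt k v)
  Distinct-swapAt k {v} (u , l) = Unique-swapAt k u , ≡.trans (↭-length (swapAt-↭ k v)) l

  -- π k realises u_{k+1}
  π : ℕ → Fn → Fn
  π k f v = if ascent k v then f (swapAt k v) else β * f v

  π-cong : ∀ k {f g : Fn} v → (∀ u → f u ≈ g u) → π k f v ≈ π k g v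
  π-cong k v f≈g with ascent k v
  ... | true  = f≈g _
  ... | false = *-congˡ (f≈g v)

  π-cong-Distinct : ∀ k {f g : Fn} {v} → Distinct v → (∀ u → Distinct u → f u ≈ g u) → π k f v ≈ π k g v
  π-cong-Distinct k {v = v} dv f≈g with ascent k v
  ... | true  = f≈g _ (Distinct-swapAt k dv)
  ... | false = *-congˡ (f≈g v dv)

  π-linear : ∀ k (f g : Fn) y v → π k (λ u → f u + y * g u) v ≈ π k f v + y * π k g v
  π-linear k f g y v with ascent k v
  ... | true  = refl
  ... | false = solve 4 (λ b F Y G → b :* (F :+ Y :* G) := b :* F :+ Y :* (b :* G)) refl β (f v) y (g v)

  π-zero : ∀ k v → π k (λ _ → 0#) v ≈ 0#
  π-zero k v with ascent k v
  ... | true  = refl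
  ... | false = zeroʳ β

  π-idem : ∀ k (f : Fn) v → π k (π k f) v ≈ β * π k f v
  π-idem k f v with ascent k v in asc
  ... | true rewrite ascent-swapAt-ascent k v asc = refl
  ... | false = refl

  π-comm : ∀ p r (f : Fn) v → π p (π (2 ℕ.+ p ℕ.+ r) f) v ≈ π (2 ℕ.+ p ℕ.+ r) (π p f) v
  π-comm p r f v rewrite ascent-swapAt-far p r v | ascent-far-swapAt p r v | swapAt-comm p r v
    with ascent p v | ascent (2 ℕ.+ p ℕ.+ r) v
  ... | true  | true  = refl
  ... | true  | false = refl
  ... | false | true  = refl
  ... | false | false = refl

  private
    <ᵇ-true : ∀ {x y} → x < y → (x ℕ.<ᵇ y) ≡ true
    <ᵇ-true {x} {y} x<y = dec-true (x <? y) x<y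

    <ᵇ-false : ∀ {x y} → x < y → (y ℕ.<ᵇ x) ≡ false
    <ᵇ-false {x} {y} x<y = dec-false (y <? x) (ℕₚ.<-asym x<y)

  π-braid₃ : ∀ x y z w (f : Fn) → x ≢ y → x ≢ z → y ≢ z →
             π 0 (π 1 (π 0 f)) (x ∷ y ∷ z ∷ w) ≈ π 1 (π 0 (π 1 f)) (x ∷ y ∷ z ∷ w)
  π-braid₃ x y z w f x≢y x≢z y≢z with ℕₚ.<-cmp x y | ℕₚ.<-cmp y z | ℕₚ.<-cmp x z
  ... | tri≈ _ x≡y _ | _            | _            = ⊥-elim (x≢y x≡y)
  ... | _            | tri≈ _ y≡z _ | _            = ⊥-elim (y≢z y≡z)
  ... | _            | _            | tri≈ _ x≡z _ = ⊥-elim (x≢z x≡z)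
  ... | tri< x<y _ _ | tri< y<z _ _ | tri> _ _ z<x = ⊥-elim (ℕₚ.<-asym (ℕₚ.<-trans x<y y<z) z<x)
  ... | tri> _ _ y<x | tri> _ _ z<y | tri< x<z _ _ = ⊥-elim (ℕₚ.<-asym (ℕₚ.<-trans z<y y<x) x<z)
  ... | tri< x<y _ _ | tri< y<z _ _ | tri< x<z _ _
    rewrite <ᵇ-true x<y | <ᵇ-false x<y | <ᵇ-true y<z | <ᵇ-false y<z | <ᵇ-true x<z  = refl
  ... | tri< x<y _ _ | tri> _ _ z<y | tri< x<z _ _
    rewrite <ᵇ-true x<y | <ᵇ-false x<y | <ᵇ-true z<y | <ᵇ-false z<y | <ᵇ-true x<z  = refl
  ... | tri< x<y _ _ | tri> _ _ z<y | tri> _ _ z<x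
    rewrite <ᵇ-true x<y | <ᵇ-false x<y | <ᵇ-true z<y | <ᵇ-false z<y | <ᵇ-false z<x = refl
  ... | tri> _ _ y<x | tri< y<z _ _ | tri< x<z _ _
    rewrite <ᵇ-true y<x | <ᵇ-false y<x | <ᵇ-true y<z | <ᵇ-false y<z | <ᵇ-true x<z  = refl
  ... | tri> _ _ y<x | tri< y<z _ _ | tri> _ _ z<x
    rewrite <ᵇ-true y<x | <ᵇ-false y<x | <ᵇ-true y<z | <ᵇ-false y<z | <ᵇ-false z<x = refl
  ... | tri> _ _ y<x | tri> _ _ z<y | tri> _ _ _
    rewrite <ᵇ-true y<x | <ᵇ-false y<x | <ᵇ-true z<y | <ᵇ-false z<y = refl

  π-braid : ∀ p (f : Fn) {v} → Unique v → 2 ℕ.+ p < length v →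
            π p (π (suc p) (π p f)) v ≈ π (suc p) (π p (π (suc p) f)) v
  π-braid zero    f {x ∷ y ∷ z ∷ w} ((x≢y ∷ x≢z ∷ _) ∷ (y≢z ∷ _) ∷ _) _ = π-braid₃ x y z w f x≢y x≢z y≢z
  π-braid zero    f {x ∷ y ∷ []} _ (s≤s (s≤s ()))
  π-braid zero    f {x ∷ []}     _ (s≤s ())
  π-braid (suc p) f {x ∷ v} (_ ∷ u) (s≤s p<) = π-braid p (f ∘ (x ∷_)) u p<

  H : ℕ → Carrier → Fn → Fn
  H L x f v = f v + x * π (L ∸ 1) f v

  HWord : Set c
  HWord = List (ℕ × Carrier)

  ⟦_⟧ : HWord → Fn → Fn
  ⟦ []           ⟧ f = f
  ⟦ (L , x) ∷ ws ⟧ f = H L x (⟦ ws ⟧ f)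

  ⟦⟧-++ : ∀ ws ms f v → ⟦ ws ++ ms ⟧ f v ≈ ⟦ ws ⟧ (⟦ ms ⟧ f) v
  ⟦⟧-++ ws ms f v = reflexive (≡.cong-app (++-homo ws) v)
    where ++-homo : ∀ ws → ⟦ ws ++ ms ⟧ f ≡ ⟦ ws ⟧ (⟦ ms ⟧ f)
          ++-homo []             = ≡.refl
          ++-homo ((L , x) ∷ ws) = ≡.cong (H L x) (++-homo ws)

  H-cong : ∀ L x {f g : Fn} {v} → Distinct v → (∀ u → Distinct u → f u ≈ g u) → H L x f v ≈ H L x g v
  H-cong L x dv f≈g = +-cong (f≈g _ dv) (*-congˡ (π-cong-Distinct (L ∸ 1) dv f≈g))

  ⟦⟧-cong : ∀ ws {f g : Fn} {v} → Distinct v → (∀ u → Distinct u → f u ≈ g u) → ⟦ ws ⟧ f v ≈ ⟦ ws ⟧ g v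
  ⟦⟧-cong []             dv f≈g = f≈g _ dv
  ⟦⟧-cong ((L , x) ∷ ws) dv f≈g = H-cong L x dv (λ u du → ⟦⟧-cong ws du f≈g)

  -- equality of actions on lists of n distinct numbers, the only ones on which the braid relation holds
  infix 4 _≋_
  record _≋_ (ws ms : HWord) : Set (c Level.⊔ ℓ) where
    constructor mk≋
    field run : ∀ v → Distinct v → ∀ f → ⟦ ws ⟧ f v ≈ ⟦ ms ⟧ f v
  open _≋_ public

  ≋-refl : ∀ {ws} → ws ≋ ws
  ≋-refl = mk≋ λ _ _ _ → refl

  ≋-reflexive : ∀ {ws ms} → ws ≡ ms → ws ≋ ms
  ≋-reflexive ≡.refl = ≋-refl

  ≋-sym : ∀ {ws ms} → ws ≋ ms → ms ≋ ws
  ≋-sym e = mk≋ λ v dv f → sym (run e v dv f)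

  ≋-trans : ∀ {ws ms ks} → ws ≋ ms → ms ≋ ks → ws ≋ ks
  ≋-trans e e′ = mk≋ λ v dv f → trans (run e v dv f) (run e′ v dv f)

  ≋-setoid : Setoid c (c Level.⊔ ℓ)
  ≋-setoid = record { Carrier = HWord ; _≈_ = _≋_
                    ; isEquivalence = record { refl = ≋-refl ; sym = ≋-sym ; trans = ≋-trans } }

  ≋-++ : ∀ {ws ws′ ms ms′} → ws ≋ ws′ → ms ≋ ms′ → ws ++ ms ≋ ws′ ++ ms′
  ≋-++ {ws} {ws′} {ms} {ms′} e e′ = mk≋ λ v dv f → begin
    ⟦ ws ++ ms ⟧ f v        ≈⟨ ⟦⟧-++ ws ms f v ⟩
    ⟦ ws ⟧ (⟦ ms ⟧ f) v     ≈⟨ ⟦⟧-cong ws dv (λ u du → run e′ u du f) ⟩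
    ⟦ ws ⟧ (⟦ ms′ ⟧ f) v    ≈⟨ run e v dv (⟦ ms′ ⟧ f) ⟩
    ⟦ ws′ ⟧ (⟦ ms′ ⟧ f) v   ≈⟨ ⟦⟧-++ ws′ ms′ f v ⟨
    ⟦ ws′ ++ ms′ ⟧ f v      ∎

  ≋-++ˡ : ∀ ws {ms ms′} → ms ≋ ms′ → ws ++ ms ≋ ws ++ ms′
  ≋-++ˡ ws = ≋-++ (≋-refl {ws})

  ≋-++ʳ : ∀ {ws ws′} ms → ws ≋ ws′ → ws ++ ms ≋ ws′ ++ ms
  ≋-++ʳ ms e = ≋-++ e (≋-refl {ms})

  H-H : ∀ L M x y (f : Fn) v →
        H L x (H M y f) v ≈ f v + y * π (M ∸ 1) f v + x * (π (L ∸ 1) f v + y * π (L ∸ 1) (π (M ∸ 1) f) v)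
  H-H L M x y f v = +-congˡ (*-congˡ (π-linear (L ∸ 1) f (π (M ∸ 1) f) y v))

  H-H-H : ∀ l m k x z y (f : Fn) v → H (suc l) x (H (suc m) z (H (suc k) y f)) v ≈
          (f v + y * π k f v + z * (π m f v + y * π m (π k f) v))
          + x * ((π l f v + y * π l (π k f) v) + z * (π l (π m f) v + y * π l (π m (π k f)) v))
  H-H-H l m k x z y f v = +-cong (H-H (suc m) (suc k) z y f v) (*-congˡ (begin
      π l (H (suc m) z (H (suc k) y f)) v
    ≈⟨ π-cong l v (H-H (suc m) (suc k) z y f) ⟩
      π l (λ u → f u + y * π k f u + z * (π m f u + y * π m (π k f) u)) v
    ≈⟨ π-linear l (λ u → f u + y * π k f u) (λ u → π m f u + y * π m (π k f) u) z v ⟩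
      π l (λ u → f u + y * π k f u) v + z * π l (λ u → π m f u + y * π m (π k f) u) v
    ≈⟨ +-cong (π-linear l f (π k f) y v) (*-congˡ (π-linear l (π m f) (π m (π k f)) y v)) ⟩
      (π l f v + y * π l (π k f) v) + z * (π l (π m f) v + y * π l (π m (π k f)) v)
    ∎))

  ⊕-comm : ∀ x y → x ⊕ y ≈ y ⊕ x
  ⊕-comm x y = solve 3 (λ b x y → x :+ y :+ b :* x :* y := y :+ x :+ b :* y :* x) refl β x y

  bar-⊕ : ∀ y yinv → (1# + β * y) * yinv ≈ 1# → bar y yinv ⊕ y ≈ 0#
  bar-⊕ y yinv inv = begin
      - (y * yinv) + y + β * - (y * yinv) * y
    ≈⟨ +-congʳ (+-congˡ (trans (sym (*-identityʳ y)) (*-congˡ (sym inv)))) ⟩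
      - (y * yinv) + y * ((1# + β * y) * yinv) + β * - (y * yinv) * y
    ≈⟨ solve 4 (λ N Y V B → N :+ Y :* ((con 1 :+ B :* Y) :* V) :+ B :* N :* Y := (N :+ Y :* V) :* (con 1 :+ B :* Y))
               refl (- (y * yinv)) y yinv β ⟩
      (- (y * yinv) + y * yinv) * (1# + β * y)
    ≈⟨ trans (*-congʳ (-‿inverseˡ (y * yinv))) (zeroˡ _) ⟩
      0#
    ∎

  ≋-merge : ∀ L x y → (L , x) ∷ (L , y) ∷ [] ≋ (L , x ⊕ y) ∷ []
  ≋-merge L x y = mk≋ λ v _ f → begin
      H L x (H L y f) v
    ≈⟨ H-H L L x y f v ⟩
      f v + y * π l f v + x * (π l f v + y * π l (π l f) v)
    ≈⟨ +-congˡ (*-congˡ (+-congˡ (*-congˡ (π-idem l f v)))) ⟩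
      f v + y * π l f v + x * (π l f v + y * (β * π l f v))
    ≈⟨ solve 5 (λ F P X Y B → F :+ Y :* P :+ X :* (P :+ Y :* (B :* P)) := F :+ (X :+ Y :+ B :* X :* Y) :* P)
               refl (f v) (π l f v) x y β ⟩
      f v + (x ⊕ y) * π l f v
    ∎
    where l = L ∸ 1

  ≋-weight : ∀ L {x y} → x ≈ y → (L , x) ∷ [] ≋ (L , y) ∷ []
  ≋-weight L x≈y = mk≋ λ _ _ _ → +-congˡ (*-congʳ x≈y)

  ≋-unit : ∀ L → (L , 0#) ∷ [] ≋ []
  ≋-unit L = mk≋ λ _ _ _ → trans (+-congˡ (zeroˡ _)) (+-identityʳ _)

  ≋-cancel : ∀ L x y → x ⊕ y ≈ 0# → (L , x) ∷ (L , y) ∷ [] ≋ []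
  ≋-cancel L x y x⊕y≈0 = ≋-trans (≋-merge L x y) (≋-trans (≋-weight L x⊕y≈0) (≋-unit L))

  ≋-comm : ∀ s L x y → 1 ≤ s → 2 ℕ.+ s ≤ L → (s , x) ∷ (L , y) ∷ [] ≋ (L , y) ∷ (s , x) ∷ []
  ≋-comm (suc p) L x y _ 2+s≤L with ℕₚ.m≤n⇒∃[o]m+o≡n 2+s≤L
  ... | r , ≡.refl = mk≋ λ v _ f → begin
      H (suc p) x (H L y f) v
    ≈⟨ H-H (suc p) L x y f v ⟩
      f v + y * π q f v + x * (π p f v + y * π p (π q f) v)
    ≈⟨ +-congˡ (*-congˡ (+-congˡ (*-congˡ (π-comm p r f v)))) ⟩
      f v + y * π q f v + x * (π p f v + y * π q (π p f) v)
    ≈⟨ solve 6 (λ F P Q X Y C → F :+ Y :* Q :+ X :* (P :+ Y :* C) := F :+ X :* P :+ Y :* (Q :+ X :* C))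
               refl (f v) (π p f v) (π q f v) x y (π q (π p f) v) ⟩
      f v + x * π p f v + y * (π q f v + x * π q (π p f) v)
    ≈⟨ H-H L (suc p) y x f v ⟨
      H L y (H (suc p) x f) v
    ∎
    where q = 2 ℕ.+ p ℕ.+ r

  ≋-yang-baxter : ∀ p x y → 2 ℕ.+ p < n →
          (suc p , x) ∷ (2 ℕ.+ p , x ⊕ y) ∷ (suc p , y) ∷ [] ≋ (2 ℕ.+ p , y) ∷ (suc p , x ⊕ y) ∷ (2 ℕ.+ p , x) ∷ []
  ≋-yang-baxter p x y 2+p<n = mk≋ λ v (uv , lv) f → begin
      H (suc p) x (H (2 ℕ.+ p) z (H (suc p) y f)) v
    ≈⟨ H-H-H p (suc p) p x z y f v ⟩
      (f v + y * π₀ f v + z * (π₁ f v + y * π₁ (π₀ f) v))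
        + x * ((π₀ f v + y * π₀ (π₀ f) v) + z * (π₀ (π₁ f) v + y * π₀ (π₁ (π₀ f)) v))
    ≈⟨ +-congˡ (*-congˡ (+-cong (+-congˡ (*-congˡ (π-idem p f v)))
                                 (*-congˡ (+-congˡ (*-congˡ (π-braid p f uv (≡.subst (2 ℕ.+ p <_) (≡.sym lv) 2+p<n))))))) ⟩
      (f v + y * π₀ f v + z * (π₁ f v + y * π₁ (π₀ f) v))
        + x * ((π₀ f v + y * (β * π₀ f v)) + z * (π₀ (π₁ f) v + y * π₁ (π₀ (π₁ f)) v))
    ≈⟨ solve 9 (λ F A B C D T X Y Bt →
         (F :+ Y :* A :+ (X :+ Y :+ Bt :* X :* Y) :* (B :+ Y :* C)) :+ X :* ((A :+ Y :* (Bt :* A)) :+ (X :+ Y :+ Bt :* X :* Y) :* (D :+ Y :* T))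
         := (F :+ X :* B :+ (X :+ Y :+ Bt :* X :* Y) :* (A :+ X :* D)) :+ Y :* ((B :+ X :* (Bt :* B)) :+ (X :+ Y :+ Bt :* X :* Y) :* (C :+ X :* T)))
         refl (f v) (π₀ f v) (π₁ f v) (π₁ (π₀ f) v) (π₀ (π₁ f) v) (π₁ (π₀ (π₁ f)) v) x y β ⟩
      (f v + x * π₁ f v + z * (π₀ f v + x * π₀ (π₁ f) v))
        + y * ((π₁ f v + x * (β * π₁ f v)) + z * (π₁ (π₀ f) v + x * π₁ (π₀ (π₁ f)) v))
    ≈⟨ +-congˡ (*-congˡ (+-congʳ (+-congˡ (*-congˡ (π-idem (suc p) f v))))) ⟨
      (f v + x * π₁ f v + z * (π₀ f v + x * π₀ (π₁ f) v))
        + y * ((π₁ f v + x * π₁ (π₁ f) v) + z * (π₁ (π₀ f) v + x * π₁ (π₀ (π₁ f)) v))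
    ≈⟨ H-H-H (suc p) p (suc p) y z x f v ⟨
      H (2 ℕ.+ p) y (H (suc p) z (H (2 ℕ.+ p) x f)) v
    ∎
    where z = x ⊕ y ; π₀ = π p ; π₁ = π (suc p)

-- The factorisation G(a) = G(b̄) · ∏_Δ h_{i+j-1}(a_i ⊕ b_j)

module Factorisation {c ℓ : Level} (R : CommutativeRing c ℓ) (β : CommutativeRing.Carrier R) (n : ℕ) where

  open Hecke R β
  open HeckeAction R β n
  open SetoidReasoning ≋-setoid

  hw : List ℕ → Carrier → HWord
  hw ks x = map (λ k → (k , x)) ks

  down up : ℕ → ℕ → Carrier → HWord
  down s m x = hw (reverse (range s m)) x
  up   s m x = hw (range s m) x

  hw-reverse-∷ : ∀ k ks x → hw (reverse (k ∷ ks)) x ≡ hw (reverse ks) x ++ (k , x) ∷ []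
  hw-reverse-∷ k ks x = ≡.trans (≡.cong (λ ks → hw ks x) (unfold-reverse k ks)) (map-++ (λ k → (k , x)) (reverse ks) (k ∷ []))

  down-∷ʳ : ∀ s m x → down s (suc m) x ≡ down (suc s) m x ++ (s , x) ∷ []
  down-∷ʳ s m x = hw-reverse-∷ s (range (suc s) m) x

  Above : ℕ → HWord → Set c
  Above t ws = All (λ (L , _) → t ≤ L) ws

  Above-hw : ∀ {t} ks x → All (t ≤_) ks → Above t (hw ks x)
  Above-hw ks x t≤ks = map⁺ t≤ks

  Above-down : ∀ {t} s m x → t ≤ s → Above t (down s m x)
  Above-down s m x t≤s = Above-hw (reverse (range s m)) x (All-resp-↭ (↭-sym (↭-reverse (range s m))) (range-≥ s m t≤s))

  Above-up : ∀ {t} s m x → t ≤ s → Above t (up s m x)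
  Above-up s m x t≤s = Above-hw (range s m) x (range-≥ s m t≤s)

  ≋-commute-past : ∀ s x ws → 1 ≤ s → Above (2 ℕ.+ s) ws → (s , x) ∷ ws ≋ ws ++ (s , x) ∷ []
  ≋-commute-past s x []             _   _          = ≋-refl
  ≋-commute-past s x ((L , y) ∷ ws) 1≤s (2+s≤L ∷ a) =
    ≋-trans (≋-++ʳ ws (≋-comm s L x y 1≤s 2+s≤L)) (≋-++ˡ ((L , y) ∷ []) (≋-commute-past s x ws 1≤s a))

  down-up-cancel : ∀ ks x y → x ⊕ y ≈ 0# → hw (reverse ks) x ++ hw ks y ≋ []
  down-up-cancel []       x y x⊕y≈0 = ≋-refl
  down-up-cancel (k ∷ ks) x y x⊕y≈0 = begin
      hw (reverse (k ∷ ks)) x ++ hw (k ∷ ks) y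
    ≡⟨ ≡.cong (_++ hw (k ∷ ks) y) (hw-reverse-∷ k ks x) ⟩
      (hw (reverse ks) x ++ (k , x) ∷ []) ++ hw (k ∷ ks) y
    ≡⟨ ++-assoc (hw (reverse ks) x) ((k , x) ∷ []) (hw (k ∷ ks) y) ⟩
      hw (reverse ks) x ++ ((k , x) ∷ (k , y) ∷ []) ++ hw ks y
    ≈⟨ ≋-++ˡ (hw (reverse ks) x) (≋-++ʳ (hw ks y) (≋-cancel k x y x⊕y≈0)) ⟩
      hw (reverse ks) x ++ hw ks y
    ≈⟨ down-up-cancel ks x y x⊕y≈0 ⟩
      []
    ∎

  -- the word of A^{(n)}_s(x₁) A^{(n)}_{s+1}(x₂) ⋯
  Gw : ℕ → List Carrier → HWord
  Gw s []       = []
  Gw s (x ∷ xs) = down s (n ∸ s) x ++ Gw (suc s) xs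

  Above-Gw : ∀ {t} s xs → t ≤ s → Above t (Gw s xs)
  Above-Gw s []       t≤s = []
  Above-Gw s (x ∷ xs) t≤s = ++⁺ (Above-down s (n ∸ s) x t≤s) (Above-Gw (suc s) xs (ℕₚ.m≤n⇒m≤1+n t≤s))

  Bw : List ℕ → (ℕ → Carrier) → HWord
  Bw []       y = []
  Bw (j ∷ js) y = up j (n ∸ j) (y j) ++ Bw js y

  Bw-++ : ∀ js ks y → Bw (js ++ ks) y ≡ Bw js y ++ Bw ks y
  Bw-++ []       ks y = ≡.refl
  Bw-++ (j ∷ js) ks y = ≡.trans (≡.cong (up j (n ∸ j) (y j) ++_) (Bw-++ js ks y))
                                (≡.sym (++-assoc (up j (n ∸ j) (y j)) (Bw js y) (Bw ks y)))

  Gw-Bw-cancel : ∀ s m (x y : ℕ → Carrier) → (∀ j → s ≤ j → j < s ℕ.+ m → x j ⊕ y j ≈ 0#) →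
                 Gw s (map x (range s m)) ++ Bw (rangeDown s m) y ≋ []
  Gw-Bw-cancel s zero    x y x⊕y≈0 = ≋-refl
  Gw-Bw-cancel s (suc m) x y x⊕y≈0 = begin
      (down s k (x s) ++ G′) ++ Bw (rangeDown s (suc m)) y
    ≡⟨ ≡.cong ((down s k (x s) ++ G′) ++_) (≡.trans (≡.cong (λ js → Bw js y) (rangeDown-∷ʳ s m)) (Bw-++ (rangeDown (suc s) m) (s ∷ []) y)) ⟩
      (down s k (x s) ++ G′) ++ B′ ++ up s k (y s) ++ []
    ≡⟨ ≡.trans (++-assoc (down s k (x s)) G′ _) (≡.cong (down s k (x s) ++_) (≡.sym (++-assoc G′ B′ _))) ⟩
      down s k (x s) ++ (G′ ++ B′) ++ up s k (y s) ++ []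
    ≈⟨ ≋-++ˡ (down s k (x s)) (≋-++ʳ (up s k (y s) ++ []) inner) ⟩
      down s k (x s) ++ up s k (y s) ++ []
    ≡⟨ ≡.sym (++-assoc (down s k (x s)) (up s k (y s)) []) ⟩
      (down s k (x s) ++ up s k (y s)) ++ []
    ≈⟨ ≋-++ʳ [] (down-up-cancel (range s k) (x s) (y s) (x⊕y≈0 s ℕₚ.≤-refl (ℕₚ.m<m+n s (s≤s z≤n)))) ⟩
      []
    ∎
    where
    k  = n ∸ s
    G′ = Gw (suc s) (map x (range (suc s) m))
    B′ = Bw (rangeDown (suc s) m) y
    inner : G′ ++ B′ ≋ []
    inner = Gw-Bw-cancel (suc s) m x y λ j s<j j< → x⊕y≈0 j (ℕₚ.<⇒≤ s<j) (≡.subst (j <_) (≡.sym (ℕₚ.+-suc s m)) j<)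

  private
    n∸s≡m : ∀ s {m} → s ℕ.+ m ≡ n → n ∸ s ≡ m
    n∸s≡m s {m} s+m≡n = ≡.trans (≡.cong (_∸ s) (≡.sym s+m≡n)) (ℕₚ.m+n∸m≡n s m)

    suc-+ : ∀ {s m} → s ℕ.+ suc m ≡ n → suc s ℕ.+ m ≡ n
    suc-+ {s} {m} e = ≡.trans (≡.sym (ℕₚ.+-suc s m)) e

  -- Induction on m: once the outer letters h_s are commuted past the inner blocks,
  -- the Yang–Baxter relation moves x ⊕ y from position s + 1 to position s.
  up-down-exchange : ∀ s m x y → 1 ≤ s → s ℕ.+ suc m ≡ n →
                     up s (suc m) y ++ down s (suc m) x ≋ down (suc s) m x ++ (s , x ⊕ y) ∷ up (suc s) m y
  up-down-exchange s zero    x y _ _ = ≋-trans (≋-merge s y x) (≋-weight s (⊕-comm y x))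
  up-down-exchange s@(suc q) (suc m) x y 1≤s s+m+2≡n = begin
      ((s , y) ∷ up s₁ (suc m) y) ++ down s (2 ℕ.+ m) x
    ≡⟨ ≡.cong (((s , y) ∷ up s₁ (suc m) y) ++_) (down-∷ʳ s (suc m) x) ⟩
      (s , y) ∷ up s₁ (suc m) y ++ down s₁ (suc m) x ++ (s , x) ∷ []
    ≡⟨ ≡.cong ((s , y) ∷_) (≡.sym (++-assoc (up s₁ (suc m) y) (down s₁ (suc m) x) _)) ⟩
      (s , y) ∷ (up s₁ (suc m) y ++ down s₁ (suc m) x) ++ (s , x) ∷ []
    ≈⟨ ≋-++ˡ ((s , y) ∷ []) (≋-++ʳ ((s , x) ∷ []) (up-down-exchange s₁ m x y (s≤s z≤n) (suc-+ {s} {suc m} s+m+2≡n))) ⟩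
      (s , y) ∷ (down s₂ m x ++ (s₁ , x ⊕ y) ∷ up s₂ m y) ++ (s , x) ∷ []
    ≡⟨ ≡.cong ((s , y) ∷_) (++-assoc (down s₂ m x) _ _) ⟩
      ((s , y) ∷ down s₂ m x) ++ (s₁ , x ⊕ y) ∷ up s₂ m y ++ (s , x) ∷ []
    ≈⟨ ≋-++ (≋-commute-past s y (down s₂ m x) 1≤s (Above-down s₂ m x ℕₚ.≤-refl))
            (≋-++ˡ ((s₁ , x ⊕ y) ∷ []) (≋-sym (≋-commute-past s x (up s₂ m y) 1≤s (Above-up s₂ m y ℕₚ.≤-refl)))) ⟩
      (down s₂ m x ++ (s , y) ∷ []) ++ (s₁ , x ⊕ y) ∷ (s , x) ∷ up s₂ m y
    ≡⟨ ++-assoc (down s₂ m x) _ _ ⟩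
      down s₂ m x ++ ((s , y) ∷ (s₁ , x ⊕ y) ∷ (s , x) ∷ []) ++ up s₂ m y
    ≈⟨ ≋-++ˡ (down s₂ m x) (≋-++ʳ (up s₂ m y) braid) ⟩
      down s₂ m x ++ ((s₁ , x) ∷ (s , x ⊕ y) ∷ (s₁ , y) ∷ []) ++ up s₂ m y
    ≡⟨ ≡.sym (++-assoc (down s₂ m x) ((s₁ , x) ∷ []) _) ⟩
      (down s₂ m x ++ (s₁ , x) ∷ []) ++ (s , x ⊕ y) ∷ (s₁ , y) ∷ up s₂ m y
    ≡⟨ ≡.cong (_++ (s , x ⊕ y) ∷ (s₁ , y) ∷ up s₂ m y) (≡.sym (down-∷ʳ s₁ m x)) ⟩
      down s₁ (suc m) x ++ (s , x ⊕ y) ∷ up s₁ (suc m) y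
    ∎
    where
    s₁ = suc s ; s₂ = suc s₁
    2+q<n : 2 ℕ.+ q < n
    2+q<n = ≡.subst (2 ℕ.+ q <_) s+m+2≡n (ℕₚ.≤-trans (ℕₚ.m≤m+n (3 ℕ.+ q) m)
              (ℕₚ.≤-reflexive (≡.sym (≡.trans (ℕₚ.+-suc s (suc m)) (≡.cong suc (ℕₚ.+-suc s m))))))
    braid : (s , y) ∷ (s₁ , x ⊕ y) ∷ (s , x) ∷ [] ≋ (s₁ , x) ∷ (s , x ⊕ y) ∷ (s₁ , y) ∷ []
    braid = ≋-trans (≋-++ˡ ((s , y) ∷ []) (≋-++ʳ ((s , x) ∷ []) (≋-weight s₁ (⊕-comm x y))))
           (≋-trans (≋-yang-baxter q y x 2+q<n)
                    (≋-++ˡ ((s₁ , x) ∷ []) (≋-++ʳ ((s₁ , y) ∷ []) (≋-weight s (⊕-comm y x)))))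

  row : ℕ → Carrier → List Carrier → HWord
  row s y []       = []
  row s y (x ∷ xs) = (s , x ⊕ y) ∷ row (suc s) y xs

  up-Gw-exchange : ∀ s xs y → 1 ≤ s → s ℕ.+ length xs ≡ n →
                   up s (n ∸ s) y ++ Gw s xs ≋ Gw (suc s) xs ++ row s y xs
  up-Gw-exchange s []       y _   e = ≋-reflexive (≡.cong (λ k → up s k y ++ []) (n∸s≡m s e))
  up-Gw-exchange s (x ∷ xs) y 1≤s e = begin
      up s (n ∸ s) y ++ down s (n ∸ s) x ++ Gw s₁ xs
    ≡⟨ ≡.cong (λ k → up s k y ++ down s k x ++ Gw s₁ xs) (n∸s≡m s e) ⟩
      up s (suc m) y ++ down s (suc m) x ++ Gw s₁ xs
    ≡⟨ ≡.sym (++-assoc (up s (suc m) y) _ _) ⟩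
      (up s (suc m) y ++ down s (suc m) x) ++ Gw s₁ xs
    ≈⟨ ≋-++ʳ (Gw s₁ xs) (up-down-exchange s m x y 1≤s e) ⟩
      (down s₁ m x ++ (s , x ⊕ y) ∷ up s₁ m y) ++ Gw s₁ xs
    ≡⟨ ++-assoc (down s₁ m x) _ _ ⟩
      down s₁ m x ++ (s , x ⊕ y) ∷ up s₁ m y ++ Gw s₁ xs
    ≈⟨ ≋-++ˡ (down s₁ m x) (≋-++ˡ ((s , x ⊕ y) ∷ []) IH) ⟩
      down s₁ m x ++ (s , x ⊕ y) ∷ Gw s₂ xs ++ row s₁ y xs
    ≈⟨ ≋-++ˡ (down s₁ m x) (≋-++ʳ (row s₁ y xs) (≋-commute-past s (x ⊕ y) (Gw s₂ xs) 1≤s (Above-Gw s₂ xs ℕₚ.≤-refl))) ⟩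
      down s₁ m x ++ (Gw s₂ xs ++ (s , x ⊕ y) ∷ []) ++ row s₁ y xs
    ≡⟨ ≡.trans (≡.cong (down s₁ m x ++_) (++-assoc (Gw s₂ xs) _ _)) (≡.sym (++-assoc (down s₁ m x) _ _)) ⟩
      (down s₁ m x ++ Gw s₂ xs) ++ (s , x ⊕ y) ∷ row s₁ y xs
    ≡⟨ ≡.cong (λ k → (down s₁ k x ++ Gw s₂ xs) ++ (s , x ⊕ y) ∷ row s₁ y xs) (≡.sym (n∸s≡m s₁ (suc-+ e))) ⟩
      (down s₁ (n ∸ s₁) x ++ Gw s₂ xs) ++ (s , x ⊕ y) ∷ row s₁ y xs
    ∎
    where
    s₁ = suc s ; s₂ = suc s₁ ; m = length xs
    IH : up s₁ m y ++ Gw s₁ xs ≋ Gw s₂ xs ++ row s₁ y xs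
    IH = ≡.subst (λ k → up s₁ k y ++ Gw s₁ xs ≋ Gw s₂ xs ++ row s₁ y xs) (n∸s≡m s₁ (suc-+ e))
                 (up-Gw-exchange s₁ xs y (s≤s z≤n) (suc-+ e))

  -- the block of the last entry has length n ∸ (t + length xs) = 0
  Gw-∷ʳ : ∀ t xs x → t ℕ.+ length xs ≡ n → Gw t (xs ++ x ∷ []) ≡ Gw t xs
  Gw-∷ʳ t []       x e = ≡.cong (λ k → down t k x ++ []) (n∸s≡m t e)
  Gw-∷ʳ t (y ∷ ys) x e = ≡.cong (down t (n ∸ t) y ++_) (Gw-∷ʳ (suc t) ys x (suc-+ e))

  module _ (a b : ℕ → Carrier) where

    rows : List ℕ → HWord
    rows []       = []
    rows (j ∷ js) = row j (b j) (map a (range 1 (n ∸ j))) ++ rows js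

    rows-++ : ∀ js ks → rows (js ++ ks) ≡ rows js ++ rows ks
    rows-++ []       ks = ≡.refl
    rows-++ (j ∷ js) ks = ≡.trans (≡.cong (row j (b j) (map a (range 1 (n ∸ j))) ++_) (rows-++ js ks))
                                  (≡.sym (++-assoc (row j (b j) (map a (range 1 (n ∸ j)))) (rows js) (rows ks)))

    length-map-range : ∀ i m → length (map a (range i m)) ≡ m
    length-map-range i m = ≡.trans (length-map a (range i m)) (length-range i m)

    Bw-Gw≋rows : ∀ s m → 1 ≤ s → s ℕ.+ m ≡ n → Bw (rangeDown s m) b ++ Gw s (map a (range 1 m)) ≋ rows (rangeDown s m)
    Bw-Gw≋rows s zero    _   _ = ≋-refl
    Bw-Gw≋rows s (suc m) 1≤s e = begin
        Bw (rangeDown s (suc m)) b ++ Gw s xs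
      ≡⟨ ≡.cong (_++ Gw s xs) (≡.trans (≡.cong (λ js → Bw js b) (rangeDown-∷ʳ s m)) (Bw-++ (rangeDown (suc s) m) (s ∷ []) b)) ⟩
        (B′ ++ up s (n ∸ s) (b s) ++ []) ++ Gw s xs
      ≡⟨ ≡.trans (++-assoc B′ _ _) (≡.cong (λ w → B′ ++ w ++ Gw s xs) (++-identityʳ (up s (n ∸ s) (b s)))) ⟩
        B′ ++ up s (n ∸ s) (b s) ++ Gw s xs
      ≈⟨ ≋-++ˡ B′ (up-Gw-exchange s xs (b s) 1≤s (≡.trans (≡.cong (s ℕ.+_) (length-map-range 1 (suc m))) e)) ⟩
        B′ ++ Gw (suc s) xs ++ row s (b s) xs
      ≡⟨ ≡.trans (≡.sym (++-assoc B′ _ _)) (≡.cong (λ w → (B′ ++ w) ++ row s (b s) xs) Gw-drop-last) ⟩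
        (B′ ++ Gw (suc s) (map a (range 1 m))) ++ row s (b s) xs
      ≈⟨ ≋-++ʳ (row s (b s) xs) (Bw-Gw≋rows (suc s) m (s≤s z≤n) (suc-+ e)) ⟩
        rows (rangeDown (suc s) m) ++ row s (b s) xs
      ≡⟨ ≡.sym (≡.trans (≡.cong rows (rangeDown-∷ʳ s m)) (≡.trans (rows-++ (rangeDown (suc s) m) (s ∷ []))
           (≡.cong (rows (rangeDown (suc s) m) ++_) (≡.trans (++-identityʳ _) (≡.cong (λ k → row s (b s) (map a (range 1 k))) (n∸s≡m s e)))))) ⟩
        rows (rangeDown s (suc m))
      ∎
      where
      xs = map a (range 1 (suc m))
      B′ = Bw (rangeDown (suc s) m) b
      Gw-drop-last : Gw (suc s) xs ≡ Gw (suc s) (map a (range 1 m))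
      Gw-drop-last = ≡.trans (≡.cong (λ is → Gw (suc s) (map a is)) (range-∷ʳ 1 m))
                     (≡.trans (≡.cong (Gw (suc s)) (map-++ a (range 1 m) (suc m ∷ [])))
                       (Gw-∷ʳ (suc s) (map a (range 1 m)) (a (suc m)) (≡.trans (≡.cong (suc s ℕ.+_) (length-map-range 1 m)) (suc-+ e))))

    boxLetter : Box → ℕ × Carrier
    boxLetter d = (sref d , wt a b d)

    ΔWord : HWord
    ΔWord = map boxLetter (Δ n)

    boxLetter-row : ∀ t k j s → s ≡ t ℕ.+ suc j ∸ 1 →
                    map boxLetter (map (λ i → (i , suc j)) (range t k)) ≡ row s (b (suc j)) (map a (range t k))
    boxLetter-row t zero    j s e = ≡.refl
    boxLetter-row t (suc k) j s e = ≡.cong₂ _∷_ (≡.cong (λ L → (L , a t ⊕ b (suc j))) (≡.sym e))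
                                                (boxLetter-row (suc t) k j (suc s) e′)
      where e′ : suc s ≡ suc t ℕ.+ suc j ∸ 1
            e′ = ≡.trans (≡.cong suc e) (≡.trans (≡.cong (λ L → suc (L ∸ 1)) (ℕₚ.+-suc t j)) (≡.sym (ℕₚ.+-suc t j)))

    boxLetter-rows : ∀ js → All (1 ≤_) js →
                     map boxLetter (concatMap (λ j → map (λ i → (i , j)) (from1 (n ∸ j))) js) ≡ rows js
    boxLetter-rows []            _        = ≡.refl
    boxLetter-rows (suc j ∷ js) (_ ∷ 1≤js) =
      ≡.trans (map-++ boxLetter (map (λ i → (i , suc j)) (from1 (n ∸ suc j))) _)
              (≡.cong₂ _++_ (≡.trans (≡.cong (λ is → map boxLetter (map (λ i → (i , suc j)) is)) (map-+-upTo 1 (n ∸ suc j)))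
                                     (boxLetter-row 1 (n ∸ suc j) j (suc j) ≡.refl))
                            (boxLetter-rows js 1≤js))

    ΔWord≡rows : ΔWord ≡ rows (rangeDown 1 (n ∸ 1))
    ΔWord≡rows = ≡.trans (≡.cong (λ js → map boxLetter (concatMap (λ j → map (λ i → (i , j)) (from1 (n ∸ j))) js))
                                 (map-suc-downFrom (n ∸ 1)))
                         (boxLetter-rows (rangeDown 1 (n ∸ 1)) (rangeDown-≥1 (n ∸ 1)))

    G-factorisation : (ā : ℕ → Carrier) → 1 ≤ n → (∀ j → 1 ≤ j → j < n → ā j ⊕ b j ≈ 0#) →
                      Gw 1 (map a (range 1 (n ∸ 1))) ≋ Gw 1 (map ā (range 1 (n ∸ 1))) ++ ΔWord
    G-factorisation ā 1≤n ā⊕b≈0 = begin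
        Ga
      ≈⟨ ≋-++ʳ Ga (Gw-Bw-cancel 1 m ā b λ j 1≤j j< → ā⊕b≈0 j 1≤j (≡.subst (j <_) 1+m≡n j<)) ⟨
        (Gā ++ Bw (rangeDown 1 m) b) ++ Ga
      ≡⟨ ++-assoc Gā _ _ ⟩
        Gā ++ Bw (rangeDown 1 m) b ++ Ga
      ≈⟨ ≋-++ˡ Gā (Bw-Gw≋rows 1 m (s≤s z≤n) 1+m≡n) ⟩
        Gā ++ rows (rangeDown 1 m)
      ≡⟨ ≡.cong (Gā ++_) ΔWord≡rows ⟨
        Gā ++ ΔWord
      ∎
      where
      m = n ∸ 1
      1+m≡n : 1 ℕ.+ m ≡ n
      1+m≡n = ℕₚ.m+[n∸m]≡n 1≤n
      Ga = Gw 1 (map a (range 1 m))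
      Gā = Gw 1 (map ā (range 1 m))

module Representation {c ℓ : Level} (R : CommutativeRing c ℓ) (β : CommutativeRing.Carrier R) (n : ℕ) where

  open Hecke R β
  open HeckeAction R β n
  open Factorisation R β n using (hw; down; Gw; ΔWord; G-factorisation)
  open ListSums R
  open SetoidReasoning setoid
  open import Algebra.Solver.Ring.NaturalCoefficients.Default commutativeSemiring using (solve; _:=_; _:+_; _:*_)

  actWord : List ℕ → Fn → Fn
  actWord []      f = f
  actWord (i ∷ p) f = π (i ∸ 1) (actWord p f)

  act : Elem → Fn → Fn
  act X f v = sumR (map (λ (p , x) → x * actWord p f v) X)

  actWord-cong : ∀ p {f g : Fn} {v} → Distinct v → (∀ u → Distinct u → f u ≈ g u) → actWord p f v ≈ actWord p g v
  actWord-cong []      dv f≈g = f≈g _ dv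
  actWord-cong (i ∷ p) dv f≈g = π-cong-Distinct (i ∸ 1) dv (λ u du → actWord-cong p du f≈g)

  actWord-++ : ∀ p q (f : Fn) v → actWord (p ++ q) f v ≈ actWord p (actWord q f) v
  actWord-++ []      q f v = refl
  actWord-++ (i ∷ p) q f v = π-cong (i ∸ 1) v (actWord-++ p q f)

  actWord-linear : ∀ p y (f g : Fn) v → actWord p (λ u → y * f u + g u) v ≈ y * actWord p f v + actWord p g v
  actWord-linear []      y f g v = refl
  actWord-linear (i ∷ p) y f g v = begin
      π k (actWord p (λ u → y * f u + g u)) v
    ≈⟨ π-cong k v (λ u → trans (actWord-linear p y f g u) (+-comm _ _)) ⟩
      π k (λ u → actWord p g u + y * actWord p f u) v
    ≈⟨ π-linear k (actWord p g) (actWord p f) y v ⟩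
      π k (actWord p g) v + y * π k (actWord p f) v
    ≈⟨ +-comm _ _ ⟩
      y * π k (actWord p f) v + π k (actWord p g) v
    ∎
    where k = i ∸ 1

  actWord-zero : ∀ p v → actWord p (λ _ → 0#) v ≈ 0#
  actWord-zero []      v = refl
  actWord-zero (i ∷ p) v = trans (π-cong (i ∸ 1) v (actWord-zero p)) (π-zero (i ∸ 1) v)

  act-cong : ∀ X {f g : Fn} {v} → Distinct v → (∀ u → Distinct u → f u ≈ g u) → act X f v ≈ act X g v
  act-cong []            dv f≈g = refl
  act-cong ((p , x) ∷ X) dv f≈g = +-cong (*-congˡ (actWord-cong p dv f≈g)) (act-cong X dv f≈g)

  act-prefix : ∀ p x Y (f : Fn) v → act (map (λ (q , y) → (p ++ q , x * y)) Y) f v ≈ x * actWord p (act Y f) v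
  act-prefix p x []            f v = sym (trans (*-congˡ (actWord-zero p v)) (zeroʳ x))
  act-prefix p x ((q , y) ∷ Y) f v = begin
      x * y * actWord (p ++ q) f v + act (map (λ (q , y) → (p ++ q , x * y)) Y) f v
    ≈⟨ +-cong (*-congˡ (actWord-++ p q f v)) (act-prefix p x Y f v) ⟩
      x * y * actWord p (actWord q f) v + x * actWord p (act Y f) v
    ≈⟨ solve 4 (λ X Y A B → X :* Y :* A :+ X :* B := X :* (Y :* A :+ B)) refl x y _ _ ⟩
      x * (y * actWord p (actWord q f) v + actWord p (act Y f) v)
    ≈⟨ *-congˡ (actWord-linear p y (actWord q f) (act Y f) v) ⟨
      x * actWord p (act ((q , y) ∷ Y) f) v
    ∎

  act-· : ∀ X Y (f : Fn) v → act (X · Y) f v ≈ act X (act Y f) v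
  act-· []            Y f v = refl
  act-· ((p , x) ∷ X) Y f v = begin
      act (pY ++ X · Y) f v
    ≡⟨ ≡.cong sumR (map-++ term pY (X · Y)) ⟩
      sumR (map term pY ++ map term (X · Y))
    ≈⟨ sum-++ (map term pY) (map term (X · Y)) ⟩
      act pY f v + act (X · Y) f v
    ≈⟨ +-cong (act-prefix p x Y f v) (act-· X Y f v) ⟩
      x * actWord p (act Y f) v + act X (act Y f) v
    ∎
    where
    pY = map (λ (q , y) → (p ++ q , x * y)) Y
    term : List ℕ × Carrier → Carrier
    term (q , y) = y * actWord q f v

  infix 4 _actsAs_
  record _actsAs_ (X : Elem) (w : HWord) : Set (c Level.⊔ ℓ) where
    constructor mkActsAs
    field act≈⟦⟧ : ∀ f {v} → Distinct v → act X f v ≈ ⟦ w ⟧ f v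
  open _actsAs_ public

  one-actsAs : one actsAs []
  one-actsAs = mkActsAs λ _ _ → trans (+-identityʳ _) (*-identityˡ _)

  h-actsAs : ∀ i x → h i x actsAs (i , x) ∷ []
  h-actsAs i x = mkActsAs λ _ _ → +-cong (*-identityˡ _) (+-identityʳ _)

  ·-actsAs : ∀ {X Y w w′} → X actsAs w → Y actsAs w′ → X · Y actsAs w ++ w′
  ·-actsAs {X} {Y} {w} {w′} X≈w Y≈w′ = mkActsAs λ f {v} dv → begin
    act (X · Y) f v         ≈⟨ act-· X Y f v ⟩
    act X (act Y f) v       ≈⟨ act-cong X dv (λ u du → act≈⟦⟧ Y≈w′ f du) ⟩
    act X (⟦ w′ ⟧ f) v      ≈⟨ act≈⟦⟧ X≈w (⟦ w′ ⟧ f) dv ⟩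
    ⟦ w ⟧ (⟦ w′ ⟧ f) v      ≈⟨ ⟦⟧-++ w w′ f v ⟨
    ⟦ w ++ w′ ⟧ f v         ∎

  product-actsAs : ∀ (F : ℕ → Elem) (W : ℕ → HWord) → (∀ i → F i actsAs W i) →
                   ∀ is → foldr _·_ one (map F is) actsAs concatMap W is
  product-actsAs F W F≈W []       = one-actsAs
  product-actsAs F W F≈W (i ∷ is) = ·-actsAs (F≈W i) (product-actsAs F W F≈W is)

  A-actsAs : ∀ i x → A n i x actsAs down i (n ∸ i) x
  A-actsAs i x = ≡.subst (A n i x actsAs_) word
    (product-actsAs (λ k → h k x) (λ k → (k , x) ∷ []) (λ k → h-actsAs k x) (reverse (map (i ℕ.+_) (upTo (n ∸ i)))))
    where
    word : concatMap (λ k → (k , x) ∷ []) (reverse (map (i ℕ.+_) (upTo (n ∸ i)))) ≡ down i (n ∸ i) x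
    word = ≡.trans (≡.sym (concatMap-map [_] (λ k → (k , x)) ks))
           (≡.trans (concatMap-pure (hw ks x)) (≡.cong (λ ks → hw (reverse ks) x) (map-+-upTo i (n ∸ i))))
      where ks = reverse (map (i ℕ.+_) (upTo (n ∸ i)))

  G-actsAs : ∀ a → G n a actsAs Gw 1 (map a (range 1 (n ∸ 1)))
  G-actsAs a = ≡.subst₂ _actsAs_
    (≡.cong (λ is → foldr _·_ one (map (λ i → A n i (a i)) is)) (≡.sym (map-+-upTo 1 (n ∸ 1))))
    (blocks≡Gw 1 (n ∸ 1))
    (product-actsAs (λ i → A n i (a i)) blocks (λ i → A-actsAs i (a i)) (range 1 (n ∸ 1)))
    where
    blocks : ℕ → HWord
    blocks i = down i (n ∸ i) (a i)
    blocks≡Gw : ∀ s m → concatMap blocks (range s m) ≡ Gw s (map a (range s m))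
    blocks≡Gw s zero    = ≡.refl
    blocks≡Gw s (suc m) = ≡.cong (blocks s ++_) (blocks≡Gw (suc s) m)

  G-factorisation-act : ∀ a b ā → 1 ≤ n → (∀ j → 1 ≤ j → j < n → ā j ⊕ b j ≈ 0#) →
                        ∀ f {v} → Distinct v → act (G n a) f v ≈ act (G n ā) (⟦ ΔWord a b ⟧ f) v
  G-factorisation-act a b ā 1≤n ā⊕b≈0 f {v} dv = begin
      act (G n a) f v                    ≈⟨ act≈⟦⟧ (G-actsAs a) f dv ⟩
      ⟦ Gw 1 (as a) ⟧ f v                ≈⟨ run (G-factorisation a b ā 1≤n ā⊕b≈0) v dv f ⟩
      ⟦ Gw 1 (as ā) ++ ΔWord a b ⟧ f v   ≈⟨ ⟦⟧-++ (Gw 1 (as ā)) (ΔWord a b) f v ⟩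
      ⟦ Gw 1 (as ā) ⟧ (⟦ ΔWord a b ⟧ f) v ≈⟨ act≈⟦⟧ (G-actsAs ā) (⟦ ΔWord a b ⟧ f) dv ⟨
      act (G n ā) (⟦ ΔWord a b ⟧ f) v    ∎
    where as : (ℕ → Carrier) → List Carrier
          as x = map x (range 1 (n ∸ 1))

module Coefficients {c ℓ : Level} (R : CommutativeRing c ℓ) (β : CommutativeRing.Carrier R) (n : ℕ) where

  open Hecke R β
  open HeckeAction R β n
  open Representation R β n
  open ListSums R
  open SetoidReasoning setoid

  actWord-dstep : ∀ p v (f : Fn) → Σ[ e ∈ ℕ ] e ℕ.+ len (foldl dstep v p) ≡ length p ℕ.+ len v
                                              × actWord p f v ≈ pow β e * f (foldl dstep v p)
  actWord-dstep []      v f = 0 , ≡.refl , sym (*-identityˡ _)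
  actWord-dstep (i ∷ p) v f rewrite dstep-ascent v i with ascent (i ∸ 1) v in asc
  ... | true with actWord-dstep p (swapAt (i ∸ 1) v) f
  ...   | e , len≡ , act≈ = e , ≡.trans len≡ (≡.trans (≡.cong (length p ℕ.+_) (len-swapAt-ascent (i ∸ 1) v asc))
                                                      (ℕₚ.+-suc (length p) (len v))) , act≈
  actWord-dstep (i ∷ p) v f | false with actWord-dstep p v f
  ...   | e , len≡ , act≈ = suc e , ≡.cong suc len≡ , trans (*-congˡ act≈) (sym (*-assoc _ _ _))

  actWord-identity : ∀ p (f : Fn) → actWord p f (upTo n) ≈ pow β (length p ∸ len (dem n p)) * f (dem n p)
  actWord-identity p f with actWord-dstep p (upTo n) f
  ... | e , len≡ , act≈ = trans act≈ (*-congʳ (reflexive (≡.cong (pow β) e≡)))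
    where e≡ : e ≡ length p ∸ len (dem n p)
          e≡ = ≡.trans (≡.sym (ℕₚ.m+n∸n≡m e (len (dem n p))))
                       (≡.cong (_∸ len (dem n p)) (≡.trans len≡ (≡.trans (≡.cong (length p ℕ.+_) (len-upTo n)) (ℕₚ.+-identityʳ _))))

  demazureSum : Elem → Fn → Carrier
  demazureSum Z g = sum (map (λ (p , x) → x * (pow β (length p ∸ len (dem n p)) * g (dem n p))) Z)

  act-identity : ∀ Z (g : Fn) → act Z g (upTo n) ≈ demazureSum Z g
  act-identity Z g = sum-cong Z λ (p , x) → *-congˡ (actWord-identity p g)

  δ : List ℕ → Fn
  δ w u = if does (≡-dec ℕ._≟_ u w) then 1# else 0#

  coeff-act : ∀ w Z → coeff n w Z ≈ act Z (δ w) (upTo n)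
  coeff-act w Z = trans (sum-cong Z term≈) (sym (act-identity Z (δ w)))
    where
    term≈ : ∀ ((p , x) : List ℕ × Carrier) →
            (if does (≡-dec ℕ._≟_ (dem n p) w) then x * pow β (length p ∸ len w) else 0#)
              ≈ x * (pow β (length p ∸ len (dem n p)) * δ w (dem n p))
    term≈ (p , x) with ≡-dec ℕ._≟_ (dem n p) w
    ... | yes ≡.refl = *-congˡ (sym (*-identityʳ _))
    ... | no  _      = sym (trans (*-congˡ (zeroʳ _)) (zeroʳ x))

  demazureSum-grouped : ∀ Z (L : List (List ℕ)) (g : Fn) → Unique L → All (λ (p , _) → dem n p ∈ L) Z →
                        demazureSum Z g ≈ sum (map (λ u → coeff n u Z * g u) L)
  demazureSum-grouped [] L g uL _ = sym (trans (sum-cong L (λ u → zeroˡ (g u))) (sum-0 L))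
  demazureSum-grouped ((p , x) ∷ Z) L g uL (p∈L ∷ Z∈L) = sym (begin
      sum (map (λ u → coeff n u ((p , x) ∷ Z) * g u) L)
    ≈⟨ sum-cong L (λ u → distribʳ (g u) _ (coeff n u Z)) ⟩
      sum (map (λ u → (if does (≡-dec ℕ._≟_ (dem n p) u) then x * pow β (length p ∸ len u) else 0#) * g u + coeff n u Z * g u) L)
    ≈⟨ sum-+ L _ (λ u → coeff n u Z * g u) ⟩
      sum (map (λ u → (if does (≡-dec ℕ._≟_ (dem n p) u) then x * pow β (length p ∸ len u) else 0#) * g u) L)
        + sum (map (λ u → coeff n u Z * g u) L)
    ≈⟨ +-cong (sum-δ (≡-dec ℕ._≟_) (dem n p) L uL p∈L (λ u → x * pow β (length p ∸ len u)) g)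
              (sym (demazureSum-grouped Z L g uL Z∈L)) ⟩
      x * pow β (length p ∸ len (dem n p)) * g (dem n p) + demazureSum Z g
    ≈⟨ +-congʳ (*-assoc _ _ _) ⟩
      demazureSum ((p , x) ∷ Z) g
    ∎)

  act-fixes-identity : ∀ Z (g : Fn) → Z ≈[ n ] one → act Z g (upTo n) ≈ g (upTo n)
  act-fixes-identity Z g Z≈one = begin
      act Z g (upTo n)
    ≈⟨ act-identity Z g ⟩
      demazureSum Z g
    ≈⟨ demazureSum-grouped Z L g uL Z∈L ⟩
      sum (map (λ u → coeff n u Z * g u) L)
    ≈⟨ sum-cong-∈ L (λ u∈L → *-congʳ (Z≈one _ (L-perms u∈L))) ⟩
      sum (map (λ u → coeff n u one * g u) L)
    ≈⟨ demazureSum-grouped one L g uL (∈-deduplicate⁺ (≡-dec ℕ._≟_) {xs = L₀} (here ≡.refl) ∷ []) ⟨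
      demazureSum one g
    ≈⟨ trans (+-identityʳ _) (trans (*-identityˡ _) (trans (*-congʳ (reflexive (≡.cong (pow β) (ℕₚ.0∸n≡0 (len (upTo n)))))) (*-identityˡ _))) ⟩
      g (upTo n)
    ∎
    where
    L₀ = upTo n ∷ map (dem n ∘ proj₁) Z
    L = deduplicate (≡-dec ℕ._≟_) L₀
    uL : Unique L
    uL = deduplicate-! (≡-dec ℕ._≟_) L₀
    Z∈L : All (λ (p , _) → dem n p ∈ L) Z
    Z∈L = All.tabulate λ px∈Z → ∈-deduplicate⁺ (≡-dec ℕ._≟_) (there (∈-map⁺ (dem n ∘ proj₁) px∈Z))
    L-perms : ∀ {u} → u ∈ L → u ↭ upTo n
    L-perms u∈L with ∈-deduplicate⁻ (≡-dec ℕ._≟_) L₀ u∈L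
    ... | here ≡.refl = ↭-refl
    ... | there u∈Z with ∈-map⁻ (dem n ∘ proj₁) u∈Z
    ...   | (p , _) , _ , ≡.refl = foldl-dstep-↭ p ↭-refl

module SubwordExpansion {c ℓ : Level} (R : CommutativeRing c ℓ) (β : CommutativeRing.Carrier R) (n : ℕ) where

  open Hecke R β
  open HeckeAction R β n
  open Factorisation R β n using (boxLetter; ΔWord)
  open Coefficients R β n using (δ)
  open ListSums R
  open SetoidReasoning setoid
  open import Algebra.Solver.Ring.NaturalCoefficients.Default commutativeSemiring using (solve; _:=_; _:+_; _:*_; con)

  InRange : Box → Set
  InRange d = suc (sref d ∸ 1) < n

  Δ-InRange : All InRange (Δ n)
  Δ-InRange = concat⁺ (map⁺ (map⁺ (applyDownFrom⁺₁ id (n ∸ 1) λ {k} _ →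
                map⁺ (map⁺ (applyUpTo⁺₁ id (n ∸ suc k) λ {t} t< → box-InRange t k t<)))))
    where
    <∸⇒+< : ∀ t m k → t < k ∸ m → t ℕ.+ m < k
    <∸⇒+< t zero    k       t<k   = ≡.subst (_< k) (≡.sym (ℕₚ.+-identityʳ t)) t<k
    <∸⇒+< t (suc m) (suc k) t<k∸m = ≡.subst (_< suc k) (≡.sym (ℕₚ.+-suc t m)) (s≤s (<∸⇒+< t m k t<k∸m))
    box-InRange : ∀ t k → t < n ∸ suc k → InRange (suc t , suc k)
    box-InRange t k t< = ≡.subst (λ s → suc (s ∸ 1) < n) (≡.sym (ℕₚ.+-suc t k))
                                 (≡.subst (_< n) (ℕₚ.+-suc t k) (<∸⇒+< t (suc k) n t<))

  marks-All : ∀ {P : Box → Set} ds → All P ds → ∀ {m} → m ∈ marks ds → All (P ∘ proj₂) m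
  marks-All []       _          (here ≡.refl) = []
  marks-All {P} (d ∷ ds) (pd ∷ pds) {m} m∈ = go (marks ds) (marks-All ds pds) m∈
    where
    go : ∀ ms → (∀ {s} → s ∈ ms → All (P ∘ proj₂) s) →
         m ∈ concatMap (λ s → ((true , d) ∷ s) ∷ ((false , d) ∷ s) ∷ []) ms → All (P ∘ proj₂) m
    go (s ∷ ms) all (here ≡.refl)         = pd ∷ all (here ≡.refl)
    go (s ∷ ms) all (there (here ≡.refl)) = pd ∷ all (here ≡.refl)
    go (s ∷ ms) all (there (there m∈))    = go ms (all ∘ there) m∈

  module _ (a b : ℕ → Carrier) where

    -- the unselected boxes sitting at a descent are exactly B(D)
    markedAct : List ℕ → List (Bool × Box) → Fn → Carrier
    markedAct v []                f = f v
    markedAct v ((true  , d) ∷ m) f = if ascent (sref d ∸ 1) v then wt a b d * markedAct (rmul v (sref d)) m f else 0#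
    markedAct v ((false , d) ∷ m) f = if ascent (sref d ∸ 1) v then markedAct v m f else (1# + β * wt a b d) * markedAct v m f

    ⟦⟧-marks : ∀ ds v (f : Fn) → ⟦ map (boxLetter a b) ds ⟧ f v ≈ sum (map (λ m → markedAct v m f) (marks ds))
    ⟦⟧-marks []       v f = sym (+-identityʳ _)
    ⟦⟧-marks (d ∷ ds) v f = begin
        ⟦ map (boxLetter a b) ds ⟧ f v + wt a b d * π (sref d ∸ 1) (⟦ map (boxLetter a b) ds ⟧ f) v
      ≈⟨ split ⟩
        sum (map (λ s → markedAct v ((true , d) ∷ s) f + markedAct v ((false , d) ∷ s) f) (marks ds))
      ≈⟨ sum-pairs (marks ds) (λ s → markedAct v ((true , d) ∷ s) f) (λ s → markedAct v ((false , d) ∷ s) f) ⟨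
        sum (concatMap (λ s → markedAct v ((true , d) ∷ s) f ∷ markedAct v ((false , d) ∷ s) f ∷ []) (marks ds))
      ≡⟨ ≡.cong sum (map-concatMap (λ m → markedAct v m f) (λ s → ((true , d) ∷ s) ∷ ((false , d) ∷ s) ∷ []) (marks ds)) ⟨
        sum (map (λ m → markedAct v m f) (marks (d ∷ ds)))
      ∎
      where
      ws = map (boxLetter a b) ds
      split : ⟦ ws ⟧ f v + wt a b d * π (sref d ∸ 1) (⟦ ws ⟧ f) v ≈
              sum (map (λ s → markedAct v ((true , d) ∷ s) f + markedAct v ((false , d) ∷ s) f) (marks ds))
      split with ascent (sref d ∸ 1) v
      ... | true  = sym (begin
          sum (map (λ s → wt a b d * markedAct (rmul v (sref d)) s f + markedAct v s f) (marks ds))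
        ≈⟨ trans (sum-+ (marks ds) _ _) (+-congʳ (sum-*ˡ (marks ds) (wt a b d) _)) ⟩
          wt a b d * sum (map (λ s → markedAct (rmul v (sref d)) s f) (marks ds)) + sum (map (λ s → markedAct v s f) (marks ds))
        ≈⟨ +-cong (*-congˡ (⟦⟧-marks ds (rmul v (sref d)) f)) (⟦⟧-marks ds v f) ⟨
          wt a b d * ⟦ ws ⟧ f (rmul v (sref d)) + ⟦ ws ⟧ f v
        ≈⟨ +-comm _ _ ⟩
          ⟦ ws ⟧ f v + wt a b d * ⟦ ws ⟧ f (rmul v (sref d))
        ∎)
      ... | false = sym (begin
          sum (map (λ s → 0# + (1# + β * wt a b d) * markedAct v s f) (marks ds))
        ≈⟨ trans (sum-cong (marks ds) (λ _ → +-identityˡ _)) (sum-*ˡ (marks ds) _ _) ⟩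
          (1# + β * wt a b d) * sum (map (λ s → markedAct v s f) (marks ds))
        ≈⟨ *-congˡ (⟦⟧-marks ds v f) ⟨
          (1# + β * wt a b d) * ⟦ ws ⟧ f v
        ≈⟨ solve 3 (λ X B W → (con 1 :+ B :* W) :* X := X :+ W :* (B :* X)) refl (⟦ ws ⟧ f v) β (wt a b d) ⟩
          ⟦ ws ⟧ f v + wt a b d * (β * ⟦ ws ⟧ f v)
        ∎)

    -- isRSub, read from an arbitrary starting permutation v
    IsReducedTo : List ℕ → List (Bool × Box) → List ℕ → Bool
    IsReducedTo v m w = does (≡-dec ℕ._≟_ (foldl rmul v (selected m)) w) ∧ does (length (selected m) ℕ.+ len v ℕ.≟ len w)

    private
      *-if : ∀ (t : Bool) y x → y * (if t then x else 0#) ≈ (if t then y * x else 0#)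
      *-if true  y x = refl
      *-if false y x = zeroʳ y

    len-rmul-descent : ∀ {v} d → Distinct v → InRange d → ascent (sref d ∸ 1) v ≡ false →
                       suc (len (rmul v (sref d))) ≡ len v
    len-rmul-descent {v} d (uv , lv) d< = len-swapAt-descent (sref d ∸ 1) v uv (≡.subst (suc (sref d ∸ 1) <_) (≡.sym lv) d<)

    selected-descent-not-reduced : ∀ d m v w → Distinct v → InRange d → ascent (sref d ∸ 1) v ≡ false →
                                   IsReducedTo v ((true , d) ∷ m) w ≡ false
    selected-descent-not-reduced d m v w dv d< asc
      with ≡-dec ℕ._≟_ (foldl rmul (rmul v (sref d)) (selected m)) w | suc (length (selected m)) ℕ.+ len v ℕ.≡ᵇ len w in len≡ᵇ
    ... | no  _      | _     = ≡.refl
    ... | yes _      | false = ≡.refl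
    ... | yes ≡.refl | true  = ⊥-elim (ℕₚ.<-irrefl (≡.sym len≡) too-short)
      where
      v′ = rmul v (sref d)
      len≡ : suc (length (selected m)) ℕ.+ len v ≡ len (foldl rmul v′ (selected m))
      len≡ = ℕₚ.≡ᵇ⇒≡ _ _ (≡.subst T (≡.sym len≡ᵇ) _)
      too-short : len (foldl rmul v′ (selected m)) < suc (length (selected m)) ℕ.+ len v
      too-short = ≡.subst (λ k → len (foldl rmul v′ (selected m)) < suc (length (selected m)) ℕ.+ k) (len-rmul-descent d dv d< asc)
                    (s≤s (ℕₚ.≤-trans (len-foldl-rmul (selected m) v′) (ℕₚ.+-monoʳ-≤ (length (selected m)) (ℕₚ.n≤1+n (len v′)))))

    markedAct-δ : ∀ m v w → Distinct v → All (InRange ∘ proj₂) m →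
                  markedAct v m (δ w) ≈ (if IsReducedTo v m w then walk a b v m else 0#)
    markedAct-δ [] v w _ _ with ≡-dec ℕ._≟_ v w
    ... | no  _      = refl
    ... | yes ≡.refl rewrite dec-true (len v ℕ.≟ len v) ≡.refl = refl
    markedAct-δ ((true , d) ∷ m) v w dv (d< ∷ m<) with ascent (sref d ∸ 1) v in asc
    ... | true = begin
        wt a b d * markedAct v′ m (δ w)
      ≈⟨ *-congˡ (markedAct-δ m v′ w (Distinct-swapAt (sref d ∸ 1) dv) m<) ⟩
        wt a b d * (if IsReducedTo v′ m w then walk a b v′ m else 0#)
      ≈⟨ *-if (IsReducedTo v′ m w) (wt a b d) (walk a b v′ m) ⟩
        (if IsReducedTo v′ m w then wt a b d * walk a b v′ m else 0#)
      ≡⟨ ≡.cong (λ t → if t then wt a b d * walk a b v′ m else 0#) same-test ⟩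
        (if IsReducedTo v ((true , d) ∷ m) w then wt a b d * walk a b v′ m else 0#)
      ∎
      where
      v′ = rmul v (sref d)
      same-test : IsReducedTo v′ m w ≡ IsReducedTo v ((true , d) ∷ m) w
      same-test = ≡.cong (λ k → does (≡-dec ℕ._≟_ (foldl rmul v′ (selected m)) w) ∧ does (k ℕ.≟ len w))
                         (≡.trans (≡.cong (length (selected m) ℕ.+_) (len-swapAt-ascent (sref d ∸ 1) v asc)) (ℕₚ.+-suc _ _))
    ... | false = reflexive (≡.cong (λ t → if t then _ else 0#) (≡.sym (selected-descent-not-reduced d m v w dv d< asc)))
    markedAct-δ ((false , d) ∷ m) v w dv (d< ∷ m<) with ascent (sref d ∸ 1) v in asc | len (rmul v (sref d)) <? len v
    ... | true  | no  _  = markedAct-δ m v w dv m<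
    ... | true  | yes lt = ⊥-elim (ℕₚ.<-asym lt (ℕₚ.≤-reflexive (≡.sym (len-swapAt-ascent (sref d ∸ 1) v asc))))
    ... | false | yes _  = trans (*-congˡ (markedAct-δ m v w dv m<)) (*-if (IsReducedTo v m w) _ (walk a b v m))
    ... | false | no  ≮  = ⊥-elim (≮ (ℕₚ.≤-reflexive (len-rmul-descent d dv d< asc)))

    ⟦Δ⟧-δ-identity : ∀ w → Distinct (upTo n) → ⟦ ΔWord a b ⟧ (δ w) (upTo n) ≈ rhs a b n w
    ⟦Δ⟧-δ-identity w did = trans (⟦⟧-marks (Δ n) (upTo n) (δ w)) (sum-cong-∈ (marks (Δ n)) λ {m} m∈ →
        trans (markedAct-δ m (upTo n) w did (marks-All (Δ n) Δ-InRange m∈))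
              (reflexive (≡.cong (λ t → if t then walk a b (upTo n) m else 0#) (test≡isRSub m))))
      where
      test≡isRSub : ∀ m → IsReducedTo (upTo n) m w ≡ isRSub a b n w m
      test≡isRSub m = ≡.cong (λ k → does (≡-dec ℕ._≟_ (foldl rmul (upTo n) (selected m)) w) ∧ does (k ℕ.≟ len w))
                             (≡.trans (≡.cong (length (selected m) ℕ.+_) (len-upTo n)) (ℕₚ.+-identityʳ _))

theorem4 : {c ℓ : Level} (R : CommutativeRing c ℓ) (β : CommutativeRing.Carrier R) →
    let open Hecke R β in
    (n : ℕ) → 2 ≤ n →
    (a b binv : ℕ → Carrier) →
    (∀ i → 1 ≤ i → i < n → (1# + β * b i) * binv i ≈ 1#) →
    (X : Elem) → InAlg n X →
    (X · G n (λ i → bar (b i) (binv i))) ≈[ n ] one →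
    (w : List ℕ) → w ↭ upTo n →
    coeff n w (X · G n a) ≈ rhs a b n w
theorem4 R β n 2≤n a b binv b-invertible X _ X·Gb̄≈one w _ = begin
    coeff n w (X · G n a)                ≈⟨ coeff-act w (X · G n a) ⟩
    act (X · G n a) (δ w) (upTo n)       ≈⟨ act-· X (G n a) (δ w) (upTo n) ⟩
    act X (act (G n a) (δ w)) (upTo n)   ≈⟨ act-cong X id-distinct (λ _ → G-factorisation-act a b b̄ 1≤n b̄⊕b≈0 (δ w)) ⟩
    act X (act (G n b̄) g) (upTo n)       ≈⟨ act-· X (G n b̄) g (upTo n) ⟨
    act (X · G n b̄) g (upTo n)           ≈⟨ act-fixes-identity (X · G n b̄) g X·Gb̄≈one ⟩
    g (upTo n)                           ≈⟨ ⟦Δ⟧-δ-identity a b w id-distinct ⟩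
    rhs a b n w                          ∎
  where
  open Hecke R β
  open HeckeAction R β n
  open Representation R β n
  open Coefficients R β n
  open SubwordExpansion R β n
  open Factorisation R β n using (ΔWord)
  open SetoidReasoning setoid
  b̄ : ℕ → Carrier
  b̄ i = bar (b i) (binv i)
  b̄⊕b≈0 : ∀ j → 1 ≤ j → j < n → b̄ j ⊕ b j ≈ 0#
  b̄⊕b≈0 j 1≤j j<n = bar-⊕ (b j) (binv j) (b-invertible j 1≤j j<n)
  g : Fn
  g = ⟦ ΔWord a b ⟧ (δ w)
  1≤n : 1 ≤ n
  1≤n = ℕₚ.≤-trans (s≤s z≤n) 2≤n
  id-distinct : Distinct (upTo n)
  id-distinct = upTo⁺ n , length-upTo n
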